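{- Let $\mathbf{d}=(d_1,\dots,d_n)$ be a graphical sequence with $\sum_{i=1}^n d_i=4(n-1)-4$, $d_1<n-1$ and $d_n\ge 2$. Then $\mathbf{d}$ admits a realization which is a $C_4$-pivotable graph.
   Context: A degree sequence is non-increasing, $d_1\ge\dots\ge d_n\ge 0$; it is graphical if some simple graph on $v_1,\dots,v_n$ has $\deg(v_i)=d_i$ (a realization). A simple graph $G$ on $n$ vertices with exactly $2n-4$ edges is $C_4$-pivotable if $G$ contains an induced cycle $C$ of length 4 and two spanning trees whose edge sets have exactly two common edges, both of which are edges of $C$. -}

module Defs where

open import Data.Nat using (ℕ; zero; suc; _+_; _*_; _∸_; _≤_; _<_; _≥_)
open import Data.Bool using (Bool; true; false; if_then_else_; _∧_)
open import Data.Fin using (Fin; toℕ; _<?_)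
open import Data.List using (List; []; _∷_; length; map; allFin; concatMap)
open import Data.Nat.ListAction using (sum)
open import Data.Empty using (⊥)
open import Data.Sum using (_⊎_)
open import Data.List.Relation.Unary.Unique.Propositional using (Unique)
open import Data.Product using (Σ; proj₁; ∃; ∃-syntax; _×_; _,_)
open import Relation.Binary.PropositionalEquality using (_≡_; _≢_; refl; cong₂)
open import Relation.Nullary using (¬_; does)

-- A simple graph on the vertex set Fin n (vertex v_{i+1} is  i : Fin n),
-- given by a symmetric irreflexive Boolean adjacency relation.
record Graph (n : ℕ) : Set where
  field
    adj    : Fin n → Fin n → Bool
    sym    : ∀ i j → adj i j ≡ adj j i
    irrefl : ∀ i → adj i i ≡ false
open Graph public

Adj : ∀ {n} → Graph n → Fin n → Fin n → Set
Adj G i j = adj G i j ≡ true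

b2n : Bool → ℕ
b2n true  = 1
b2n false = 0

deg : ∀ {n} → Graph n → Fin n → ℕ
deg {n} G i = sum (map (λ j → b2n (adj G i j)) (allFin n))

edgeCount : ∀ {n} → Graph n → ℕ
edgeCount {n} G =
  sum (concatMap (λ i → map (λ j → b2n (does (i <? j) ∧ adj G i j)) (allFin n)) (allFin n))

-- degree sequences (indexed from 0: d i is d_{i+1})
NonIncreasing : ∀ {n} → (Fin n → ℕ) → Set
NonIncreasing {n} d = ∀ (i j : Fin n) → toℕ i ≤ toℕ j → d j ≤ d i

Realization : ∀ {n} → (Fin n → ℕ) → Graph n → Set
Realization d G = ∀ i → deg G i ≡ d i

Graphical : ∀ {n} → (Fin n → ℕ) → Set
Graphical {n} d = NonIncreasing d × Σ (Graph n) (Realization d)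

degSum : ∀ {n} → (Fin n → ℕ) → ℕ
degSum {n} d = sum (map d (allFin n))

Subgraph : ∀ {n} → Graph n → Graph n → Set
Subgraph H G = ∀ i j → Adj H i j → Adj G i j

data Reach {n} (G : Graph n) : Fin n → Fin n → Set where
  here : ∀ {u} → Reach G u u
  step : ∀ {u v w} → Adj G u v → Reach G v w → Reach G u w

Connected : ∀ {n} → Graph n → Set
Connected G = ∀ u v → Reach G u v

-- A cycle: a list v0, v1, ..., vk of distinct vertices (k ≥ 2) with
-- v_i adjacent to v_{i+1} and v_k adjacent to v_0.
Path⟶ : ∀ {n} → Graph n → Fin n → List (Fin n) → Fin n → Set
Path⟶ G u []       w = Adj G u w
Path⟶ G u (v ∷ vs) w = Adj G u v × Path⟶ G v vs w

Cycle : ∀ {n} → Graph n → List (Fin n) → Set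
Cycle G []       = ⊥
Cycle G (v ∷ vs) = Unique (v ∷ vs) × (2 ≤ length vs) × Path⟶ G v vs v

Acyclic : ∀ {n} → Graph n → Set
Acyclic {n} G = ∀ (c : List (Fin n)) → ¬ Cycle G c

IsTree : ∀ {n} → Graph n → Set
IsTree G = Connected G × Acyclic G

SpanningTree : ∀ {n} → Graph n → Graph n → Set
SpanningTree G T = Subgraph T G × IsTree T

common : ∀ {n} → Graph n → Graph n → Graph n
common {n} S T = record
  { adj    = λ i j → adj S i j ∧ adj T i j
  ; sym    = λ i j → cong2 (sym S i j) (sym T i j)
  ; irrefl = λ i → helper (irrefl S i)
  }
  where
  cong2 = cong₂ _∧_
  helper : ∀ {i : Fin n} {b} → adj S i i ≡ false → adj S i i ∧ b ≡ false
  helper {i} {b} e rewrite e = refl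

InducedC4 : ∀ {n} → Graph n → Fin n → Fin n → Fin n → Fin n → Set
InducedC4 G a b c d =
  Unique (a ∷ b ∷ c ∷ d ∷ []) ×
  Adj G a b × Adj G b c × Adj G c d × Adj G d a ×
  adj G a c ≡ false × adj G b d ≡ false

EdgeOfC4 : ∀ {n} → Fin n → Fin n → Fin n → Fin n → Fin n → Fin n → Set
EdgeOfC4 a b c d i j =
  Same i j a b ⊎ Same i j b c ⊎ Same i j c d ⊎ Same i j d a
  where
  Same : _ → _ → _ → _ → Set
  Same x y p q = ((x ≡ p) × (y ≡ q)) ⊎ ((x ≡ q) × (y ≡ p))

C4Pivotable : ∀ {n} → Graph n → Set
C4Pivotable {n} G =
  edgeCount G ≡ 2 * n ∸ 4 ×
  Σ (Fin n) λ a → Σ (Fin n) λ b → Σ (Fin n) λ c → Σ (Fin n) λ d →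
    InducedC4 G a b c d ×
    Σ (Graph n) λ T₁ → Σ (Graph n) λ T₂ →
      SpanningTree G T₁ × SpanningTree G T₂ ×
      edgeCount (common T₁ T₂) ≡ 2 ×
      (∀ i j → Adj (common T₁ T₂) i j → EdgeOfC4 a b c d i j)

-- Induction on the number k ≥ 4 of active vertices of a degree function d with 2 ≤ d ≤ k − 2
-- on them and Σ d = 4k − 8; the theorem is the case where every vertex is active.  The invariant
-- is a pair of spanning trees T₁ ⊇ c₁c₂c₃c₄ and T₂ ⊇ c₂c₃c₄c₁ whose union realises d, which share
-- only the edges c₂c₃ and c₃c₄, and whose union misses the chords c₁c₃ and c₂c₄.  For k = 4 the
-- two paths form the 4-cycle.  For k > 4 the degree sum forces a vertex v of degree 2 or 3.  If
-- d v = 2, remove v, lower the two largest other degrees and re-attach v as a leaf of T₁ and of T₂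
-- at those two vertices.  Otherwise every degree is at least 3; remove v, lower the largest other
-- degree d a ≤ k − 5, attach v to a in T₂, and subdivide with v an edge of T₁ that does not meet a
-- and whose lower end is not c₂, c₃ or c₄: one exists, as at most d a − 1 edges of T₁ meet a while
-- T₁ has k − 2 edges.  Trees are kept as parent pointers along which a height strictly decreases.

module Submission where

open import Defs hiding (sym)
open import Data.Nat using (ℕ; zero; suc; _+_; _*_; _∸_; _≤_; _<_; _≥_; _≤?_; z≤n; s≤s)
open import Data.Nat.Properties hiding (_≟_; _<?_; <-cmp)
open import Data.Nat.Solver using (module +-*-Solver)
open +-*-Solver using (solve; _:+_; _:*_; _:=_; con)
import Data.Nat.ListAction as List
open import Data.Nat.ListAction.Properties using (sum-++)
open import Data.Bool using (Bool; true; false; _∧_; _∨_; not; if_then_else_)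
open import Data.Bool.Properties
  using (∨-comm; ∨-zeroʳ; ∨-identityʳ; ∧-identityʳ; ∧-zeroʳ; ∧-conicalˡ; ∧-conicalʳ; not-¬; ¬-not)
open import Data.Fin using (Fin; zero; suc; _<?_; fromℕ; toℕ)
open import Data.Fin.Properties using (_≟_; <-cmp; toℕ-fromℕ; toℕ≤pred[n])
open import Data.List using (List; []; _∷_; map; allFin; tabulate; concat)
open import Data.List.Properties using (map-tabulate; map-∘)
open import Data.List.Membership.Propositional using () renaming (_∈_ to _∈ˡ_)
open import Data.List.Relation.Unary.Any using (here; there)
open import Data.List.Relation.Unary.All as All using (All; []; _∷_)
open import Data.List.Relation.Unary.AllPairs using (AllPairs; []; _∷_)
open import Data.Product using (Σ; _×_; _,_; proj₂)
open import Data.Sum using (_⊎_; inj₁; inj₂; [_,_]′)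
open import Data.Empty using (⊥; ⊥-elim)
open import Data.Vec.Functional using (updateAt)
open import Data.Vec.Functional.Properties using (updateAt-updates; updateAt-minimal)
open import Function using (_∘_; const)
open import Relation.Nullary using (¬_; Dec; does; yes; no)
open import Relation.Nullary.Decidable using (dec-true; dec-false; _×-dec_; _⊎-dec_)
open import Relation.Binary.Definitions using (Total; Transitive; tri<; tri≈; tri>)
open import Relation.Binary.PropositionalEquality
open import Algebra.Properties.CommutativeMonoid.Sum +-0-commutativeMonoid
  using (sum-cong-≗; sum-replicate-zero; ∑-distrib-+; ∑-comm) renaming (sum to ∑)
open import Algebra.Properties.Semiring.Sum +-*-semiring using (*-distribˡ-sum)

private variable
  N k : ℕ

-- Equality tests, indicators and finite sums

_==_ : Fin N → Fin N → Bool
x == y = does (x ≟ y)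

==-refl : (x : Fin N) → (x == x) ≡ true
==-refl x = dec-true (x ≟ x) refl

==-≢ : {x y : Fin N} → x ≢ y → (x == y) ≡ false
==-≢ {x = x} {y} = dec-false (x ≟ y)

==-sound : {x y : Fin N} → (x == y) ≡ true → x ≡ y
==-sound {x = x} {y} eq with x ≟ y
... | yes x≡y = x≡y

==-sym : (x y : Fin N) → (x == y) ≡ (y == x)
==-sym x y with x ≟ y | y ≟ x
... | yes _    | yes _    = refl
... | no _     | no _     = refl
... | yes x≡y  | no y≢x   = ⊥-elim (y≢x (sym x≡y))
... | no x≢y   | yes y≡x  = ⊥-elim (x≢y (sym y≡x))

SameEdge : Fin N → Fin N → Fin N → Fin N → Set
SameEdge x y p q = (x ≡ p × y ≡ q) ⊎ (x ≡ q × y ≡ p)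

SameEdge? : (x y p q : Fin N) → Dec (SameEdge x y p q)
SameEdge? x y p q = (x ≟ p ×-dec y ≟ q) ⊎-dec (x ≟ q ×-dec y ≟ p)

module _ {x y p q : Fin N} where

  SameEdge-end : p ≢ q → SameEdge x y p q → x ≡ p → y ≡ q
  SameEdge-end p≢q (inj₁ (_ , y≡q)) _ = y≡q
  SameEdge-end p≢q (inj₂ (x≡q , _)) x≡p = ⊥-elim (p≢q (trans (sym x≡p) x≡q))

  ¬SameEdgeˡ : x ≢ p → x ≢ q → ¬ SameEdge x y p q
  ¬SameEdgeˡ x≢p x≢q (inj₁ (x≡p , _)) = x≢p x≡p
  ¬SameEdgeˡ x≢p x≢q (inj₂ (x≡q , _)) = x≢q x≡q

  ¬SameEdge-off : x ≢ p → y ≢ p → ¬ SameEdge x y p q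
  ¬SameEdge-off x≢p y≢p (inj₁ (x≡p , _)) = x≢p x≡p
  ¬SameEdge-off x≢p y≢p (inj₂ (_ , y≡p)) = y≢p y≡p

  SameEdge-unique : ∀ {r} → SameEdge x y p q → SameEdge x y r p → q ≡ r
  SameEdge-unique (inj₁ (refl , refl)) (inj₁ (x≡r , refl)) = x≡r
  SameEdge-unique (inj₁ (refl , refl)) (inj₂ (refl , y≡r)) = y≡r
  SameEdge-unique (inj₂ (refl , refl)) (inj₁ (x≡r , refl)) = x≡r
  SameEdge-unique (inj₂ (refl , refl)) (inj₂ (refl , y≡r)) = y≡r

  SameEdge-swap : SameEdge x y p q → SameEdge x y q p
  SameEdge-swap (inj₁ e) = inj₂ e
  SameEdge-swap (inj₂ e) = inj₁ e

∨-≡true : {P Q : Bool} → P ∨ Q ≡ true → P ≡ true ⊎ Q ≡ true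
∨-≡true {true}  _ = inj₁ refl
∨-≡true {false} q = inj₂ q

b2n-∨ : {P Q : Bool} → (P ≡ true → Q ≡ false) → b2n (P ∨ Q) ≡ b2n P + b2n Q
b2n-∨ {true}  {Q} exclusive rewrite exclusive refl = refl
b2n-∨ {false} {Q} exclusive = refl

b2n-≤-∨ : (P Q : Bool) → b2n P ≤ b2n (P ∨ Q)
b2n-≤-∨ true  Q = ≤-refl
b2n-≤-∨ false Q = z≤n

δ : Fin N → Fin N → ℕ
δ a x = b2n (x == a)

δ-same : (a : Fin N) → δ a a ≡ 1
δ-same a = cong b2n (==-refl a)

δ-other : {a x : Fin N} → x ≢ a → δ a x ≡ 0
δ-other x≢a = cong b2n (==-≢ x≢a)

infixl 6 _[_]≔_

_[_]≔_ : {X : Set} → (Fin N → X) → Fin N → X → Fin N → X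
f [ i ]≔ y = updateAt f i (const y)

≔-same : {X : Set} (f : Fin N → X) (i : Fin N) (y : X) → (f [ i ]≔ y) i ≡ y
≔-same f i y = updateAt-updates i f

≔-other : {X : Set} (f : Fin N → X) {i : Fin N} (y : X) {x : Fin N} → x ≢ i → (f [ i ]≔ y) x ≡ f x
≔-other f {i} y {x} = updateAt-minimal x i f

sum-allFin : (f : Fin N → ℕ) → List.sum (map f (allFin N)) ≡ ∑ f
sum-allFin {N} f = trans (cong List.sum (map-tabulate (λ x → x) f)) (sum-tabulate f)
  where
  sum-tabulate : ∀ {n} (g : Fin n → ℕ) → List.sum (tabulate g) ≡ ∑ g
  sum-tabulate {zero}  g = refl
  sum-tabulate {suc n} g = cong (g zero +_) (sum-tabulate (g ∘ suc))

∑-mono-≤ : {f g : Fin N → ℕ} → (∀ x → f x ≤ g x) → ∑ f ≤ ∑ g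
∑-mono-≤ {zero}  f≤g = z≤n
∑-mono-≤ {suc N} f≤g = +-mono-≤ (f≤g zero) (∑-mono-≤ (f≤g ∘ suc))

∑-scale : (c : ℕ) (f : Fin N → ℕ) → ∑ (λ x → c * f x) ≡ c * ∑ f
∑-scale c f = sym (*-distribˡ-sum c f)

∑-δ : (a : Fin N) → ∑ (δ a) ≡ 1
∑-δ {suc N} zero    = cong suc (sum-replicate-zero N)
∑-δ {suc N} (suc a) = ∑-δ a

∑-agree-off : (f g : Fin N → ℕ) (v : Fin N) → (∀ y → y ≢ v → f y ≡ g y) →
              ∑ f + g v ≡ ∑ g + f v
∑-agree-off f g v agree = begin
  ∑ f + g v                              ≡⟨ cong (∑ f +_) (sym (weight (g v))) ⟩
  ∑ f + ∑ (λ y → g v * δ v y)            ≡⟨ sym (∑-distrib-+ f _) ⟩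
  ∑ (λ y → f y + g v * δ v y)            ≡⟨ sum-cong-≗ pointwise ⟩
  ∑ (λ y → g y + f v * δ v y)            ≡⟨ ∑-distrib-+ g _ ⟩
  ∑ g + ∑ (λ y → f v * δ v y)            ≡⟨ cong (∑ g +_) (weight (f v)) ⟩
  ∑ g + f v                              ∎
  where
  open ≡-Reasoning
  weight : ∀ c → ∑ (λ y → c * δ v y) ≡ c
  weight c = trans (∑-scale c (δ v)) (trans (cong (c *_) (∑-δ v)) (*-identityʳ c))
  pointwise : ∀ y → f y + g v * δ v y ≡ g y + f v * δ v y
  pointwise y with y ≟ v
  ... | yes refl = trans (cong (f v +_) (*-identityʳ (g v)))
                   (trans (+-comm (f v) (g v)) (cong (g v +_) (sym (*-identityʳ (f v)))))
  ... | no y≢v  = cong₂ _+_ (agree y y≢v) (trans (*-zeroʳ (g v)) (sym (*-zeroʳ (f v))))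

∑-agree-off₂ : (f g : Fin N → ℕ) {v w : Fin N} → v ≢ w → (∀ y → y ≢ v → y ≢ w → f y ≡ g y) →
               ∑ f + g v + g w ≡ ∑ g + f v + f w
∑-agree-off₂ {N} f g {v} {w} v≢w agree = begin
  ∑ f + g v + g w      ≡⟨ +-assoc (∑ f) (g v) (g w) ⟩
  ∑ f + (g v + g w)    ≡⟨ cong (∑ f +_) (+-comm (g v) (g w)) ⟩
  ∑ f + (g w + g v)    ≡⟨ +-assoc (∑ f) (g w) (g v) ⟨
  ∑ f + g w + g v      ≡⟨ cong (λ t → ∑ f + t + g v) (≔-same f w (g w)) ⟨
  ∑ f + h w + g v      ≡⟨ cong (_+ g v) (∑-agree-off f h w (λ y y≢w → sym (≔-other f (g w) y≢w))) ⟩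
  ∑ h + f w + g v      ≡⟨ +-assoc (∑ h) (f w) (g v) ⟩
  ∑ h + (f w + g v)    ≡⟨ cong (∑ h +_) (+-comm (f w) (g v)) ⟩
  ∑ h + (g v + f w)    ≡⟨ +-assoc (∑ h) (g v) (f w) ⟨
  ∑ h + g v + f w      ≡⟨ cong (_+ f w) (∑-agree-off h g v h≗g) ⟩
  ∑ g + h v + f w      ≡⟨ cong (λ t → ∑ g + t + f w) (≔-other f (g w) v≢w) ⟩
  ∑ g + f v + f w      ∎
  where
  open ≡-Reasoning
  h : Fin N → ℕ
  h = f [ w ]≔ g w
  h≗g : ∀ y → y ≢ v → h y ≡ g y
  h≗g y y≢v with y ≟ w
  ... | yes refl = ≔-same f w (g w)
  ... | no y≢w   = trans (≔-other f (g w) y≢w) (agree y y≢v y≢w)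

∑-point : (f : Fin N → ℕ) (a : Fin N) → (∀ x → x ≢ a → f x ≡ 0) → ∑ f ≡ f a
∑-point {N} f a vanish = begin
  ∑ f                    ≡⟨ +-identityʳ (∑ f) ⟨
  ∑ f + 0                ≡⟨ ∑-agree-off f (λ _ → 0) a vanish ⟩
  ∑ {N} (λ _ → 0) + f a  ≡⟨ cong (_+ f a) (sum-replicate-zero N) ⟩
  f a                    ∎
  where open ≡-Reasoning

-- Vertex sets

VertexSet : ℕ → Set
VertexSet N = Fin N → Bool

infix 4 _∈_ _∉_

_∈_ _∉_ : Fin N → VertexSet N → Set
x ∈ A = A x ≡ true
x ∉ A = A x ≡ false

∣_∣ : VertexSet N → ℕ
∣ A ∣ = ∑ (b2n ∘ A)

infixl 6 _─_

_─_ : VertexSet N → Fin N → VertexSet N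
(A ─ v) x = A x ∧ not (x == v)

module _ (A : VertexSet N) (v : Fin N) where

  ∈-─ : {x : Fin N} → x ∈ A → x ≢ v → x ∈ A ─ v
  ∈-─ x∈A x≢v rewrite x∈A | ==-≢ x≢v = refl

  ─-≢ : {x : Fin N} → x ≢ v → (A ─ v) x ≡ A x
  ─-≢ {x} x≢v rewrite ==-≢ x≢v = ∧-identityʳ (A x)

  v∉─v : v ∉ A ─ v
  v∉─v rewrite ==-refl v = ∧-zeroʳ (A v)

  ─-comm : (w : Fin N) {x : Fin N} → x ≢ v → (A ─ v ─ w) x ≡ (A ─ w) x
  ─-comm w {x} x≢v = cong (_∧ not (x == w)) (─-≢ x≢v)

  ─-⊆ : {x : Fin N} → x ∈ A ─ v → x ∈ A
  ─-⊆ {x} x∈ with A x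
  ... | true = refl

  ─-≢v : {x : Fin N} → x ∈ A ─ v → x ≢ v
  ─-≢v x∈ refl = not-¬ x∈ v∉─v

  ∣─∣ : v ∈ A → ∣ A ∣ ≡ suc ∣ A ─ v ∣
  ∣─∣ v∈A = +-cancelʳ-≡ 0 _ _ (begin
    ∣ A ∣ + 0                 ≡⟨ cong (λ b → ∣ A ∣ + b2n b) v∉─v ⟨
    ∣ A ∣ + b2n ((A ─ v) v)   ≡⟨ ∑-agree-off (b2n ∘ A) (b2n ∘ (A ─ v)) v (λ y y≢v → cong b2n (sym (─-≢ y≢v))) ⟩
    ∣ A ─ v ∣ + b2n (A v)     ≡⟨ cong (λ b → ∣ A ─ v ∣ + b2n b) v∈A ⟩
    ∣ A ─ v ∣ + 1             ≡⟨ +-comm ∣ A ─ v ∣ 1 ⟩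
    suc ∣ A ─ v ∣             ≡⟨ +-identityʳ _ ⟨
    suc ∣ A ─ v ∣ + 0         ∎)
    where open ≡-Reasoning

∣∣≡0 : {A : VertexSet N} → (∀ x → x ∉ A) → ∣ A ∣ ≡ 0
∣∣≡0 {N} {A} empty = trans (sum-cong-≗ (λ x → cong b2n (empty x))) (sum-replicate-zero N)

module _ (_≼_ : ℕ → ℕ → Set) (≼-total : Total _≼_) (≼-trans : Transitive _≼_) where

  private
    ≼-refl : ∀ {m} → m ≼ m
    ≼-refl {m} = [ (λ p → p) , (λ p → p) ]′ (≼-total m m)

  extremum : (A : VertexSet N) (w : Fin N → ℕ) →
             (∀ x → x ∉ A) ⊎ Σ (Fin N) (λ a → a ∈ A × (∀ x → x ∈ A → w x ≼ w a))
  extremum {zero}  A w = inj₁ (λ ())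
  extremum {suc N} A w with extremum (A ∘ suc) (w ∘ suc) | A zero in A0
  ... | inj₁ empty | false = inj₁ λ { zero → A0 ; (suc x) → empty x }
  ... | inj₁ empty | true  = inj₂ (zero , A0 , λ { zero _ → ≼-refl ; (suc x) x∈ → ⊥-elim (not-¬ x∈ (empty x)) })
  ... | inj₂ (a , a∈ , best) | false = inj₂ (suc a , a∈ , λ { zero 0∈ → ⊥-elim (not-¬ 0∈ A0) ; (suc x) x∈ → best x x∈ })
  ... | inj₂ (a , a∈ , best) | true with ≼-total (w zero) (w (suc a))
  ...   | inj₁ 0≼a = inj₂ (suc a , a∈ , λ { zero _ → 0≼a ; (suc x) x∈ → best x x∈ })
  ...   | inj₂ a≼0 = inj₂ (zero , A0 , λ { zero _ → ≼-refl ; (suc x) x∈ → ≼-trans (best x x∈) a≼0 })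

  extremum-nonempty : {A : VertexSet N} (w : Fin N → ℕ) → ∣ A ∣ ≡ suc k →
                      Σ (Fin N) (λ a → a ∈ A × (∀ x → x ∈ A → w x ≼ w a))
  extremum-nonempty {A = A} w size with extremum A w
  ... | inj₁ empty = ⊥-elim (0≢1+n (trans (sym (∣∣≡0 empty)) size))
  ... | inj₂ best  = best

find : (A : VertexSet N) → (∀ x → x ∉ A) ⊎ Σ (Fin N) (_∈ A)
find A with extremum _≤_ ≤-total ≤-trans A (λ _ → 0)
... | inj₁ empty          = inj₁ empty
... | inj₂ (x , x∈A , _)  = inj₂ (x , x∈A)

argmax : {A : VertexSet N} (w : Fin N → ℕ) → ∣ A ∣ ≡ suc k →
         Σ (Fin N) (λ a → a ∈ A × (∀ x → x ∈ A → w x ≤ w a))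
argmax = extremum-nonempty _≤_ ≤-total ≤-trans

argmin : {A : VertexSet N} (w : Fin N → ℕ) → ∣ A ∣ ≡ suc k →
         Σ (Fin N) (λ a → a ∈ A × (∀ x → x ∈ A → w a ≤ w x))
argmin = extremum-nonempty _≥_ (λ m n → ≤-total n m) (λ p q → ≤-trans q p)

∣∣≡1 : {A : VertexSet N} {u : Fin N} → u ∈ A → (∀ y → y ∈ A → y ≡ u) → ∣ A ∣ ≡ 1
∣∣≡1 {A = A} {u} u∈ only = trans (∣─∣ A u u∈) (cong suc (∣∣≡0 λ y → ¬-not λ y∈ → ─-≢v A u y∈ (only y (─-⊆ A u y∈))))

∣∣≡2 : {A : VertexSet N} {u w : Fin N} → u ≢ w → u ∈ A → w ∈ A → (∀ y → y ∈ A → y ≡ u ⊎ y ≡ w) →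
       ∣ A ∣ ≡ 2
∣∣≡2 {A = A} {u} {w} u≢w u∈ w∈ only =
  trans (∣─∣ A u u∈) (cong suc (trans (∣─∣ (A ─ u) w (∈-─ A u w∈ (u≢w ∘ sym))) (cong suc (∣∣≡0 λ y → ¬-not (none y)))))
  where
  none : ∀ y → y ∈ A ─ u ─ w → ⊥
  none y y∈ with only y (─-⊆ A u (─-⊆ (A ─ u) w y∈))
  ... | inj₁ y≡u = ─-≢v A u (─-⊆ (A ─ u) w y∈) y≡u
  ... | inj₂ y≡w = ─-≢v (A ─ u) w y∈ y≡w

⁅_,_,_⁆ : Fin N → Fin N → Fin N → VertexSet N
⁅ a , b , c ⁆ y = ((y == a) ∨ (y == b)) ∨ (y == c)

∣⁅_,_,_⁆∣ : {a b c : Fin N} → a ≢ b → a ≢ c → b ≢ c → ∣ ⁅ a , b , c ⁆ ∣ ≡ 3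
∣⁅_,_,_⁆∣ {a = a} {b} {c} a≢b a≢c b≢c = begin
  ∑ (λ y → b2n (⁅ a , b , c ⁆ y))     ≡⟨ sum-cong-≗ split ⟩
  ∑ (λ y → δ a y + δ b y + δ c y)     ≡⟨ ∑-distrib-+ (λ y → δ a y + δ b y) (δ c) ⟩
  ∑ (λ y → δ a y + δ b y) + ∑ (δ c)   ≡⟨ cong (_+ ∑ (δ c)) (∑-distrib-+ (δ a) (δ b)) ⟩
  ∑ (δ a) + ∑ (δ b) + ∑ (δ c)         ≡⟨ cong₂ _+_ (cong₂ _+_ (∑-δ a) (∑-δ b)) (∑-δ c) ⟩
  3                                   ∎
  where
  open ≡-Reasoning
  split : ∀ y → b2n (⁅ a , b , c ⁆ y) ≡ δ a y + δ b y + δ c y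
  split y = trans (b2n-∨ {P = (y == a) ∨ (y == b)} avoid-c) (cong (_+ δ c y) (b2n-∨ {P = y == a} avoid-b))
    where
    avoid-b : (y == a) ≡ true → (y == b) ≡ false
    avoid-b y≡a rewrite ==-sound {x = y} y≡a = ==-≢ a≢b
    avoid-c : ((y == a) ∨ (y == b)) ≡ true → (y == c) ≡ false
    avoid-c e with ∨-≡true {P = y == a} e
    ... | inj₁ y≡a rewrite ==-sound {x = y} y≡a = ==-≢ a≢c
    ... | inj₂ y≡b rewrite ==-sound {x = y} y≡b = ==-≢ b≢c

pick : {A : VertexSet N} → ∣ A ∣ ≡ suc k → Σ (Fin N) (λ x → x ∈ A × ∣ A ─ x ∣ ≡ k)
pick {A = A} size with find A
... | inj₁ empty    = ⊥-elim (0≢1+n (trans (sym (∣∣≡0 empty)) size))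
... | inj₂ (x , x∈) = x , x∈ , suc-injective (trans (sym (∣─∣ A x x∈)) size)

record Distinct₄ (a b c d : Fin N) : Set where
  field
    ≢₁₂ : a ≢ b
    ≢₁₃ : a ≢ c
    ≢₁₄ : a ≢ d
    ≢₂₃ : b ≢ c
    ≢₂₄ : b ≢ d
    ≢₃₄ : c ≢ d

record Enumeration₄ (A : VertexSet N) : Set where
  field
    c₁ c₂ c₃ c₄ : Fin N
    distinct    : Distinct₄ c₁ c₂ c₃ c₄
    c₁∈ : c₁ ∈ A
    c₂∈ : c₂ ∈ A
    c₃∈ : c₃ ∈ A
    c₄∈ : c₄ ∈ A
    exhaustive : ∀ y → y ∈ A → y ≡ c₁ ⊎ y ≡ c₂ ⊎ y ≡ c₃ ⊎ y ≡ c₄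

Distinct₄⇒Unique : {a b c d : Fin N} → Distinct₄ a b c d → AllPairs _≢_ (a ∷ b ∷ c ∷ d ∷ [])
Distinct₄⇒Unique record { ≢₁₂ = ≢₁₂ ; ≢₁₃ = ≢₁₃ ; ≢₁₄ = ≢₁₄ ; ≢₂₃ = ≢₂₃ ; ≢₂₄ = ≢₂₄ ; ≢₃₄ = ≢₃₄ } =
  (≢₁₂ ∷ ≢₁₃ ∷ ≢₁₄ ∷ []) ∷ (≢₂₃ ∷ ≢₂₄ ∷ []) ∷ (≢₃₄ ∷ []) ∷ [] ∷ []

enumerate₄ : {A : VertexSet N} → ∣ A ∣ ≡ 4 → Enumeration₄ A
enumerate₄ {A = A} size with pick size
... | c₁ , c₁∈ , size₁ with pick size₁
... | c₂ , c₂∈₁ , size₂ with pick size₂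
... | c₃ , c₃∈₂ , size₃ with pick size₃
... | c₄ , c₄∈₃ , size₄ = record
  { c₁ = c₁ ; c₂ = c₂ ; c₃ = c₃ ; c₄ = c₄
  ; distinct = record
    { ≢₁₂ = ≢-sym (─-≢v A c₁ c₂∈₁)
    ; ≢₁₃ = ≢-sym (─-≢v A c₁ (─-⊆ A₂ c₂ c₃∈₂))
    ; ≢₁₄ = ≢-sym (─-≢v A c₁ (─-⊆ A₂ c₂ (─-⊆ A₃ c₃ c₄∈₃)))
    ; ≢₂₃ = ≢-sym (─-≢v A₂ c₂ c₃∈₂)
    ; ≢₂₄ = ≢-sym (─-≢v A₂ c₂ (─-⊆ A₃ c₃ c₄∈₃))
    ; ≢₃₄ = ≢-sym (─-≢v A₃ c₃ c₄∈₃) }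
  ; c₁∈ = c₁∈
  ; c₂∈ = ─-⊆ A c₁ c₂∈₁
  ; c₃∈ = ─-⊆ A c₁ (─-⊆ A₂ c₂ c₃∈₂)
  ; c₄∈ = ─-⊆ A c₁ (─-⊆ A₂ c₂ (─-⊆ A₃ c₃ c₄∈₃))
  ; exhaustive = exhaustive }
  where
  A₂ A₃ : VertexSet _
  A₂ = A ─ c₁
  A₃ = A ─ c₁ ─ c₂
  exhaustive : ∀ y → y ∈ A → y ≡ c₁ ⊎ y ≡ c₂ ⊎ y ≡ c₃ ⊎ y ≡ c₄
  exhaustive y y∈ with y ≟ c₁ | y ≟ c₂ | y ≟ c₃ | y ≟ c₄
  ... | yes y≡c₁ | _ | _ | _ = inj₁ y≡c₁
  ... | no _ | yes y≡c₂ | _ | _ = inj₂ (inj₁ y≡c₂)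
  ... | no _ | no _ | yes y≡c₃ | _ = inj₂ (inj₂ (inj₁ y≡c₃))
  ... | no _ | no _ | no _ | yes y≡c₄ = inj₂ (inj₂ (inj₂ y≡c₄))
  ... | no y≢c₁ | no y≢c₂ | no y≢c₃ | no y≢c₄ = ⊥-elim (0≢1+n (trans (sym size₄) (∣─∣ _ y y∈₄)))
    where
    y∈₄ : y ∈ A ─ c₁ ─ c₂ ─ c₃ ─ c₄
    y∈₄ = ∈-─ (A₃ ─ c₃) c₄ (∈-─ A₃ c₃ (∈-─ A₂ c₂ (∈-─ A c₁ y∈ y≢c₁) y≢c₂) y≢c₃) y≢c₄

-- Trees given by parent pointers

reach-snoc : {G : Graph N} {u v w : Fin N} → Reach G u v → Adj G v w → Reach G u w
reach-snoc here         v~w = step v~w here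
reach-snoc (step u~ p)  v~w = step u~ (reach-snoc p v~w)

reach-sym : {G : Graph N} {u v : Fin N} → Reach G u v → Reach G v u
reach-sym here                        = here
reach-sym {G = G} (step {u} {v} u~v p) = reach-snoc (reach-sym p) (trans (Graph.sym G v u) u~v)

reach-trans : {G : Graph N} {u v w : Fin N} → Reach G u v → Reach G v w → Reach G u w
reach-trans here        q = q
reach-trans (step u~ p) q = step u~ (reach-trans p q)

record RootedTree (A : VertexSet N) (root : Fin N) : Set where
  field
    parent       : Fin N → Fin N
    height       : Fin N → ℕ
    root∈        : root ∈ A
    parent∈      : ∀ x → x ∈ A ─ root → parent x ∈ A
    parent-lower : ∀ x → x ∈ A ─ root → height (parent x) < height x

module Tree {A : VertexSet N} {root : Fin N} (T : RootedTree A root) where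
  open RootedTree T

  isChildOf : Fin N → Fin N → Bool
  isChildOf x y = (A ─ root) x ∧ (parent x == y)

  Child : Fin N → Fin N → Set
  Child x y = x ∈ A ─ root × parent x ≡ y

  link : Fin N → Fin N → Bool
  link x y = isChildOf x y ∨ isChildOf y x

  isChildOf-intro : {x y : Fin N} → Child x y → isChildOf x y ≡ true
  isChildOf-intro {x} {y} (x∈ , refl) rewrite x∈ | ==-refl (parent x) = refl

  isChildOf-elim : {x y : Fin N} → isChildOf x y ≡ true → Child x y
  isChildOf-elim {x} {y} c with (A ─ root) x in x∈
  ... | true = refl , ==-sound c

  link-sym : (x y : Fin N) → link x y ≡ link y x
  link-sym x y = ∨-comm (isChildOf x y) (isChildOf y x)

  link-child : {x y : Fin N} → Child x y → link x y ≡ true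
  link-child c rewrite isChildOf-intro c = refl

  link-parent : {x y : Fin N} → Child y x → link x y ≡ true
  link-parent {x} {y} c = trans (link-sym x y) (link-child c)

  link-elim : {x y : Fin N} → link x y ≡ true → Child x y ⊎ Child y x
  link-elim {x} {y} l with isChildOf x y in xy
  ... | true  = inj₁ (isChildOf-elim xy)
  ... | false = inj₂ (isChildOf-elim l)

  child-lower : {x y : Fin N} → Child x y → height y < height x
  child-lower (x∈ , refl) = parent-lower _ x∈

  child-unique : {x y z : Fin N} → Child x y → Child x z → y ≡ z
  child-unique (_ , refl) (_ , refl) = refl

  isChildOf-irrefl : (x : Fin N) → isChildOf x x ≡ false
  isChildOf-irrefl x with isChildOf x x in c
  ... | true  = ⊥-elim (<-irrefl refl (child-lower (isChildOf-elim c)))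
  ... | false = refl

  graph : Graph N
  graph = record
    { adj    = link
    ; sym    = link-sym
    ; irrefl = λ x → cong (λ b → b ∨ b) (isChildOf-irrefl x) }

  ∣parent∣ : (x : Fin N) → ∣ isChildOf x ∣ ≡ b2n ((A ─ root) x)
  ∣parent∣ x with (A ─ root) x
  ... | true  = trans (sum-cong-≗ (λ y → cong b2n (==-sym (parent x) y))) (∑-δ (parent x))
  ... | false = sum-replicate-zero N

  tree-degree : (x : Fin N) → ∣ link x ∣ ≡ b2n ((A ─ root) x) + ∣ (λ y → isChildOf y x) ∣
  tree-degree x = begin
    ∣ link x ∣                                            ≡⟨ sum-cong-≗ split ⟩
    ∑ (λ y → b2n (isChildOf x y) + b2n (isChildOf y x))   ≡⟨ ∑-distrib-+ (b2n ∘ isChildOf x) (λ y → b2n (isChildOf y x)) ⟩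
    ∣ isChildOf x ∣ + ∣ (λ y → isChildOf y x) ∣           ≡⟨ cong (_+ ∣ (λ y → isChildOf y x) ∣) (∣parent∣ x) ⟩
    b2n ((A ─ root) x) + ∣ (λ y → isChildOf y x) ∣        ∎
    where
    open ≡-Reasoning
    split : ∀ y → b2n (link x y) ≡ b2n (isChildOf x y) + b2n (isChildOf y x)
    split y = b2n-∨ λ xy → ¬-not λ yx →
      <-asym (child-lower (isChildOf-elim xy)) (child-lower (isChildOf-elim yx))

  link-∉ : {x : Fin N} → x ∉ A → (y : Fin N) → link x y ≡ false
  link-∉ {x} x∉ y with link x y in l
  ... | false = refl
  ... | true with link-elim l
  ...   | inj₁ (x∈ , _)  = ⊥-elim (not-¬ (─-⊆ A root x∈) x∉)
  ...   | inj₂ (y∈ , refl) = ⊥-elim (not-¬ (parent∈ y y∈) x∉)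

  final : Fin N → List (Fin N) → Fin N
  final x []       = x
  final x (y ∷ ys) = final y ys

  penultimate : Fin N → Fin N → List (Fin N) → Fin N
  penultimate u x []       = u
  penultimate u x (y ∷ ys) = penultimate x y ys

  final∈ : ∀ x xs → final x xs ∈ˡ x ∷ xs
  final∈ x []       = here refl
  final∈ x (y ∷ ys) = there (final∈ y ys)

  penultimate∈ : ∀ u x xs → penultimate u x xs ∈ˡ u ∷ x ∷ xs
  penultimate∈ u x []       = here refl
  penultimate∈ u x (y ∷ ys) = there (penultimate∈ x y ys)

  -- Once a path without repeated vertices steps down to a child it keeps
  -- stepping down, except that its last step may return to the vertex before.
  descending : ∀ {u x} xs {w} → Child x u → Path⟶ graph x xs w → AllPairs _≢_ (u ∷ x ∷ xs) →
               (Child w (final x xs) × height u < height w) ⊎ w ≡ penultimate u x xs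
  descending [] xu x~w _ with link-elim x~w
  ... | inj₁ xw = inj₂ (child-unique xw xu)
  ... | inj₂ wx = inj₁ (wx , <-trans (child-lower xu) (child-lower wx))
  descending (y ∷ ys) xu (x~y , path) ((_ ∷ u≢y ∷ _) ∷ distinct) with link-elim x~y
  ... | inj₁ xy = ⊥-elim (u≢y (child-unique xu xy))
  ... | inj₂ yx with descending ys yx path distinct
  ...   | inj₁ (wc , lower) = inj₁ (wc , <-trans (child-lower xu) lower)
  ...   | inj₂ w≡ = inj₂ w≡

  path-shape : ∀ {u} xs {w} → Path⟶ graph u xs w → AllPairs _≢_ (u ∷ xs) →
               height w < height u ⊎ Child w (final u xs) ⊎ w ∈ˡ u ∷ xs
  path-shape [] u~w _ with link-elim u~w
  ... | inj₁ uw = inj₁ (child-lower uw)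
  ... | inj₂ wu = inj₂ (inj₁ wu)
  path-shape (x ∷ xs) (u~x , path) distinct@(_ ∷ distinct′) with link-elim u~x
  ... | inj₂ xu with descending xs xu path distinct
  ...   | inj₁ (wc , _) = inj₂ (inj₁ wc)
  ...   | inj₂ w≡ = inj₂ (inj₂ (subst (_∈ˡ _) (sym w≡) (penultimate∈ _ x xs)))
  path-shape (x ∷ xs) (u~x , path) distinct@(_ ∷ distinct′) | inj₁ ux with path-shape xs path distinct′
  ...   | inj₁ lower        = inj₁ (<-trans lower (child-lower ux))
  ...   | inj₂ (inj₁ wc)    = inj₂ (inj₁ wc)
  ...   | inj₂ (inj₂ w∈)    = inj₂ (inj₂ (there w∈))

  acyclic : Acyclic graph
  acyclic (v ∷ []) (_ , () , _)
  acyclic (v ∷ _ ∷ []) (_ , s≤s () , _)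
  acyclic (v ∷ x ∷ y ∷ ys) (distinct@(v∉ ∷ distinct′@(x∉ ∷ _)) , _ , v~x , path) with link-elim v~x
  ... | inj₂ xv with descending (y ∷ ys) xv path distinct
  ...   | inj₁ (_ , lower) = <-irrefl refl lower
  ...   | inj₂ v≡         = All.lookup v∉ (penultimate∈ x y ys) v≡
  acyclic (v ∷ x ∷ y ∷ ys) (distinct@(v∉ ∷ distinct′@(x∉ ∷ _)) , _ , v~x , path) | inj₁ vx
    with path-shape (y ∷ ys) path distinct′
  ...   | inj₁ lower     = <-asym lower (child-lower vx)
  ...   | inj₂ (inj₁ vc) = All.lookup x∉ (final∈ y ys) (child-unique vx vc)
  ...   | inj₂ (inj₂ v∈) = All.lookup v∉ v∈ refl

  module _ (all∈ : ∀ x → x ∈ A) where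

    climb : ∀ n x → height x < n → Reach graph x root
    climb (suc n) x below with x ≟ root
    ... | yes refl = here
    ... | no x≢root = step (link-child xc) (climb n (parent x) (≤-trans (child-lower xc) (≤-pred below)))
      where
      xc : Child x (parent x)
      xc = ∈-─ A root (all∈ x) x≢root , refl

    connected : Connected graph
    connected u v = reach-trans (climb _ u ≤-refl) (reach-sym (climb _ v ≤-refl))

module NewVertex {A : VertexSet N} {v ρ : Fin N} (v∈A : v ∈ A) (T : RootedTree (A ─ v) ρ) where
  open RootedTree T
  module Old = Tree T

  ≢v : {x : Fin N} → x ∈ A ─ v → x ≢ v
  ≢v = ─-≢v A v

  v∈A─ρ : v ∈ A ─ ρ
  v∈A─ρ = ∈-─ A ρ v∈A (λ v≡ρ → ≢v root∈ (sym v≡ρ))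

  old-nonroot : {x : Fin N} → x ≢ v → x ∈ A ─ ρ → x ∈ A ─ v ─ ρ
  old-nonroot {x} x≢v x∈ = trans (─-comm A v ρ x≢v) x∈

  old-isChildOf-v : (x : Fin N) → Old.isChildOf x v ≡ false
  old-isChildOf-v x with Old.isChildOf x v in c
  ... | false = refl
  ... | true with Old.isChildOf-elim c
  ...   | x∈ , px≡v = ⊥-elim (≢v (parent∈ x x∈) px≡v)

  parent≢v : {x : Fin N} → x ∈ A ─ v ─ ρ → parent x ≢ v
  parent≢v x∈ = ≢v (parent∈ _ x∈)

module AttachLeaf {A : VertexSet N} {v ρ : Fin N} (v∈A : v ∈ A) (T : RootedTree (A ─ v) ρ)
                  {a : Fin N} (a∈ : a ∈ A ─ v) where
  open RootedTree T
  open NewVertex v∈A T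

  parent′ : Fin N → Fin N
  parent′ = parent [ v ]≔ a

  height′ : Fin N → ℕ
  height′ = height [ v ]≔ suc (height a)

  tree : RootedTree A ρ
  tree = record
    { parent       = parent′
    ; height       = height′
    ; root∈        = ─-⊆ A v root∈
    ; parent∈      = parent∈′
    ; parent-lower = parent-lower′ }
    where
    parent∈′ : ∀ x → x ∈ A ─ ρ → parent′ x ∈ A
    parent∈′ x x∈ with x ≟ v
    ... | yes refl = trans (cong A (≔-same parent v a)) (─-⊆ A v a∈)
    ... | no x≢v   = trans (cong A (≔-other parent a x≢v)) (─-⊆ A v (parent∈ x (old-nonroot x≢v x∈)))
    parent-lower′ : ∀ x → x ∈ A ─ ρ → height′ (parent′ x) < height′ x
    parent-lower′ x x∈ with x ≟ v
    ... | yes refl rewrite ≔-same parent v a | ≔-same height v (suc (height a))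
                         | ≔-other height (suc (height a)) (≢v a∈) = ≤-refl
    ... | no x≢v rewrite ≔-other parent a x≢v | ≔-other height (suc (height a)) x≢v
                       | ≔-other height (suc (height a)) (parent≢v (old-nonroot x≢v x∈)) =
      parent-lower x (old-nonroot x≢v x∈)

  module New = Tree tree

  isChildOf-≢ : {x : Fin N} (y : Fin N) → x ≢ v → New.isChildOf x y ≡ Old.isChildOf x y
  isChildOf-≢ {x} y x≢v rewrite ≔-other parent a x≢v = cong (_∧ (parent x == y)) (sym (─-comm A v ρ x≢v))

  link-≢ : {x y : Fin N} → x ≢ v → y ≢ v → New.link x y ≡ Old.link x y
  link-≢ {x} {y} x≢v y≢v = cong₂ _∨_ (isChildOf-≢ y x≢v) (isChildOf-≢ x y≢v)

  isChildOf-v : (y : Fin N) → New.isChildOf v y ≡ (a == y)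
  isChildOf-v y rewrite v∈A─ρ | ≔-same parent v a = refl

  link-v : (y : Fin N) → New.link v y ≡ (y == a)
  link-v y with y ≟ v
  ... | yes refl = trans (Graph.irrefl New.graph v) (sym (==-≢ λ v≡a → ≢v a∈ (sym v≡a)))
  ... | no y≢v rewrite isChildOf-v y | isChildOf-≢ v y≢v | old-isChildOf-v y =
    trans (∨-identityʳ (a == y)) (==-sym a y)

module Subdivide {A : VertexSet N} {v ρ : Fin N} (v∈A : v ∈ A) (T : RootedTree (A ─ v) ρ)
                 {x₀ : Fin N} (x₀∈ : x₀ ∈ A ─ v ─ ρ) where
  open RootedTree T
  open NewVertex v∈A T

  c : Fin N
  c = parent x₀

  x₀≢v : x₀ ≢ v
  x₀≢v = ≢v (─-⊆ (A ─ v) ρ x₀∈)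

  c≢v : c ≢ v
  c≢v = parent≢v x₀∈

  x₀∈A─ρ : x₀ ∈ A ─ ρ
  x₀∈A─ρ = trans (sym (─-comm A v ρ x₀≢v)) x₀∈

  x₀-child : Old.Child x₀ c
  x₀-child = x₀∈ , refl

  c≢x₀ : c ≢ x₀
  c≢x₀ c≡x₀ = <-irrefl (cong height c≡x₀) (Old.child-lower x₀-child)

  parent′ : Fin N → Fin N
  parent′ = parent [ x₀ ]≔ v [ v ]≔ c

  height′ : Fin N → ℕ
  height′ = (λ x → 2 * height x) [ v ]≔ suc (2 * height c)

  parent′-v : parent′ v ≡ c
  parent′-v = ≔-same _ v c

  parent′-x₀ : parent′ x₀ ≡ v
  parent′-x₀ = trans (≔-other _ c x₀≢v) (≔-same parent x₀ v)

  parent′-other : {x : Fin N} → x ≢ v → x ≢ x₀ → parent′ x ≡ parent x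
  parent′-other x≢v x≢x₀ = trans (≔-other _ c x≢v) (≔-other parent v x≢x₀)

  height′-≢ : {x : Fin N} → x ≢ v → height′ x ≡ 2 * height x
  height′-≢ = ≔-other _ _

  tree : RootedTree A ρ
  tree = record
    { parent       = parent′
    ; height       = height′
    ; root∈        = ─-⊆ A v root∈
    ; parent∈      = parent∈′
    ; parent-lower = parent-lower′ }
    where
    parent∈′ : ∀ x → x ∈ A ─ ρ → parent′ x ∈ A
    parent∈′ x x∈ with x ≟ v | x ≟ x₀
    ... | yes refl | _        = trans (cong A parent′-v) (─-⊆ A v (parent∈ x₀ x₀∈))
    ... | no x≢v   | yes refl = trans (cong A parent′-x₀) v∈A
    ... | no x≢v   | no x≢x₀  = trans (cong A (parent′-other x≢v x≢x₀)) (─-⊆ A v (parent∈ x (old-nonroot x≢v x∈)))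
    parent-lower′ : ∀ x → x ∈ A ─ ρ → height′ (parent′ x) < height′ x
    parent-lower′ x x∈ with x ≟ v | x ≟ x₀
    ... | yes refl | _ rewrite parent′-v | height′-≢ c≢v | ≔-same (λ x → 2 * height x) v (suc (2 * height c)) = ≤-refl
    ... | no x≢v | yes refl rewrite parent′-x₀ | height′-≢ x≢v | ≔-same (λ x → 2 * height x) v (suc (2 * height c)) =
      subst (_≤ 2 * height x₀) (*-suc 2 (height c)) (*-monoʳ-≤ 2 (Old.child-lower x₀-child))
    ... | no x≢v | no x≢x₀ rewrite parent′-other x≢v x≢x₀ | height′-≢ x≢v
                                 | height′-≢ (parent≢v (old-nonroot x≢v x∈)) =
      *-monoʳ-< 2 (parent-lower x (old-nonroot x≢v x∈))

  module New = Tree tree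

  isChildOf-other : {x : Fin N} (y : Fin N) → x ≢ v → x ≢ x₀ → New.isChildOf x y ≡ Old.isChildOf x y
  isChildOf-other {x} y x≢v x≢x₀ rewrite parent′-other x≢v x≢x₀ =
    cong (_∧ (parent x == y)) (sym (─-comm A v ρ x≢v))

  isChildOf-v : (y : Fin N) → New.isChildOf v y ≡ (c == y)
  isChildOf-v y rewrite v∈A─ρ | parent′-v = refl

  isChildOf-x₀ : (y : Fin N) → New.isChildOf x₀ y ≡ (v == y)
  isChildOf-x₀ y rewrite x₀∈A─ρ | parent′-x₀ = refl

  old-isChildOf-x₀ : (y : Fin N) → Old.isChildOf x₀ y ≡ (c == y)
  old-isChildOf-x₀ y rewrite x₀∈ = refl

  old-link-x₀c : Old.link x₀ c ≡ true
  old-link-x₀c = Old.link-child x₀-child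

  link-x₀c : New.link x₀ c ≡ false
  link-x₀c rewrite isChildOf-x₀ c | ==-≢ (c≢v ∘ sym) | isChildOf-other x₀ c≢v c≢x₀ with Old.isChildOf c x₀ in cx₀
  ... | false = refl
  ... | true  = ⊥-elim (<-asym (Old.child-lower x₀-child) (Old.child-lower (Old.isChildOf-elim cx₀)))

  link-v : (y : Fin N) → New.link v y ≡ (y == c) ∨ (y == x₀)
  link-v y with y ≟ v
  ... | yes refl rewrite ==-≢ (c≢v ∘ sym) | ==-≢ (x₀≢v ∘ sym) = Graph.irrefl New.graph v
  ... | no y≢v with y ≟ x₀
  ...   | yes refl rewrite isChildOf-x₀ v | ==-refl v = trans (∨-zeroʳ _) (sym (∨-zeroʳ _))
  ...   | no y≢x₀ rewrite isChildOf-v y | isChildOf-other v y≢v y≢x₀ | old-isChildOf-v y = cong (_∨ false) (==-sym c y)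

  link-x₀ : {y : Fin N} → y ≢ v → y ≢ x₀ → y ≢ c → New.link x₀ y ≡ Old.link x₀ y
  link-x₀ {y} y≢v y≢x₀ y≢c rewrite isChildOf-x₀ y | old-isChildOf-x₀ y | isChildOf-other x₀ y≢v y≢x₀
                                 | ==-≢ (y≢v ∘ sym) | ==-≢ (y≢c ∘ sym) = refl

  link-other : {x y : Fin N} → x ≢ v → y ≢ v → ¬ SameEdge x y x₀ c → New.link x y ≡ Old.link x y
  link-other {x} {y} x≢v y≢v ¬e with x ≟ x₀ | y ≟ x₀
  ... | yes refl | yes refl = trans (Graph.irrefl New.graph x₀) (sym (Graph.irrefl Old.graph x₀))
  ... | yes refl | no y≢x₀ = link-x₀ y≢v y≢x₀ (λ y≡c → ¬e (inj₁ (refl , y≡c)))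
  ... | no x≢x₀  | yes refl = trans (New.link-sym x x₀)
      (trans (link-x₀ x≢v x≢x₀ (λ x≡c → ¬e (inj₂ (x≡c , refl)))) (Old.link-sym x₀ x))
  ... | no x≢x₀  | no y≢x₀ = cong₂ _∨_ (isChildOf-other y x≢v x≢x₀) (isChildOf-other x y≢v y≢x₀)

-- Degrees and certificates

degree : Graph N → Fin N → ℕ
degree G x = ∣ adj G x ∣

deg≡degree : (G : Graph N) (x : Fin N) → deg G x ≡ degree G x
deg≡degree G x = sum-allFin (b2n ∘ adj G x)

degree-extend : {G G′ : Graph N} {x v : Fin N} → (∀ y → y ≢ v → adj G′ x y ≡ adj G x y) →
                adj G x v ≡ false → degree G′ x ≡ degree G x + b2n (adj G′ x v)
degree-extend {G = G} {G′} {x} {v} agree isolated = begin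
  degree G′ x                              ≡⟨ +-identityʳ _ ⟨
  degree G′ x + b2n false                  ≡⟨ cong (λ b → degree G′ x + b2n b) isolated ⟨
  degree G′ x + b2n (adj G x v)            ≡⟨ ∑-agree-off (b2n ∘ adj G′ x) (b2n ∘ adj G x) v
                                                   (λ y y≢v → cong b2n (agree y y≢v)) ⟩
  degree G x + b2n (adj G′ x v)            ∎
  where open ≡-Reasoning

degree-reroute : {G G′ : Graph N} {x v w : Fin N} → v ≢ w →
                 (∀ y → y ≢ v → y ≢ w → adj G′ x y ≡ adj G x y) →
                 adj G x v ≡ false → adj G x w ≡ true → adj G′ x v ≡ true → adj G′ x w ≡ false →
                 degree G′ x ≡ degree G x
degree-reroute {G = G} {G′} {x} {v} {w} v≢w agree Gv Gw G′v G′w = +-cancelʳ-≡ 1 _ _ (begin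
  degree G′ x + 1                                        ≡⟨ cong (_+ 1) (+-identityʳ _) ⟨
  degree G′ x + 0 + 1                                    ≡⟨ cong₂ (λ p q → degree G′ x + b2n p + b2n q) Gv Gw ⟨
  degree G′ x + b2n (adj G x v) + b2n (adj G x w)        ≡⟨ ∑-agree-off₂ (b2n ∘ adj G′ x) (b2n ∘ adj G x) v≢w
                                                              (λ y y≢v y≢w → cong b2n (agree y y≢v y≢w)) ⟩
  degree G x + b2n (adj G′ x v) + b2n (adj G′ x w)       ≡⟨ cong₂ (λ p q → degree G x + b2n p + b2n q) G′v G′w ⟩
  degree G x + 1 + 0                                     ≡⟨ +-identityʳ _ ⟩
  degree G x + 1                                         ∎)
  where open ≡-Reasoning

handshake : (G : Graph N) → 2 * edgeCount G ≡ ∑ (degree G)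
handshake {N} G = begin
  2 * edgeCount G                       ≡⟨ cong (2 *_) edgeCount-∑ ⟩
  2 * ∑ below                           ≡⟨ cong (∑ below +_) (+-identityʳ (∑ below)) ⟩
  ∑ below + ∑ below                     ≡⟨ cong (∑ below +_) (∑-comm {N} {N} (λ i j → b2n (does (i <? j) ∧ adj G i j))) ⟩
  ∑ below + ∑ above                     ≡⟨ ∑-distrib-+ below above ⟨
  ∑ (λ i → below i + above i)           ≡⟨ sum-cong-≗ (λ i → sym (∑-distrib-+ (λ j → b2n (does (i <? j) ∧ adj G i j))
                                                                         (λ j → b2n (does (j <? i) ∧ adj G j i)))) ⟩
  ∑ (λ i → ∑ (λ j → b2n (does (i <? j) ∧ adj G i j) + b2n (does (j <? i) ∧ adj G j i)))
                                        ≡⟨ sum-cong-≗ (λ i → sum-cong-≗ (λ j → sym (split i j))) ⟩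
  ∑ (degree G)                          ∎
  where
  open ≡-Reasoning
  below above : Fin N → ℕ
  below i = ∑ (λ j → b2n (does (i <? j) ∧ adj G i j))
  above i = ∑ (λ j → b2n (does (j <? i) ∧ adj G j i))

  sum-concat : ∀ xss → List.sum (concat xss) ≡ List.sum (map List.sum xss)
  sum-concat []         = refl
  sum-concat (xs ∷ xss) = trans (sum-++ xs (concat xss)) (cong (List.sum xs +_) (sum-concat xss))

  edgeCount-∑ : edgeCount G ≡ ∑ below
  edgeCount-∑ = begin
    edgeCount G                                       ≡⟨ sum-concat (map row (allFin N)) ⟩
    List.sum (map List.sum (map row (allFin N)))      ≡⟨ cong List.sum (map-∘ (allFin N)) ⟨
    List.sum (map (List.sum ∘ row) (allFin N))        ≡⟨ sum-allFin (List.sum ∘ row) ⟩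
    ∑ (List.sum ∘ row)                                ≡⟨ sum-cong-≗ (λ i → sum-allFin (λ j → b2n (does (i <? j) ∧ adj G i j))) ⟩
    ∑ below                                           ∎
    where
    row : Fin N → List ℕ
    row i = map (λ j → b2n (does (i <? j) ∧ adj G i j)) (allFin N)

  split : ∀ i j → b2n (adj G i j) ≡ b2n (does (i <? j) ∧ adj G i j) + b2n (does (j <? i) ∧ adj G j i)
  split i j with <-cmp i j
  ... | tri< i<j _ j≮i rewrite dec-true (i <? j) i<j | dec-false (j <? i) j≮i = sym (+-identityʳ _)
  ... | tri> i≮j _ j<i rewrite dec-false (i <? j) i≮j | dec-true (j <? i) j<i = cong b2n (Graph.sym G i j)
  ... | tri≈ _ refl _  rewrite irrefl G i | ∧-zeroʳ (does (i <? i)) = refl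

infixl 6 _∪_

_∪_ : Graph N → Graph N → Graph N
G ∪ H = record
  { adj    = λ x y → adj G x y ∨ adj H x y
  ; sym    = λ x y → cong₂ _∨_ (Graph.sym G x y) (Graph.sym H x y)
  ; irrefl = λ x → cong₂ _∨_ (irrefl G x) (irrefl H x) }

record Certificate (A : VertexSet N) (d : Fin N → ℕ) : Set where
  field
    c₁ c₂ c₃ c₄ : Fin N
    distinct    : Distinct₄ c₁ c₂ c₃ c₄
    c₃∈         : c₃ ∈ A
    c₄∈         : c₄ ∈ A
    T₁          : RootedTree A c₁
    T₂          : RootedTree A c₂
    T₁-c₂       : RootedTree.parent T₁ c₂ ≡ c₁
    T₁-c₃       : RootedTree.parent T₁ c₃ ≡ c₂
    T₁-c₄       : RootedTree.parent T₁ c₄ ≡ c₃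
    T₂-c₃       : RootedTree.parent T₂ c₃ ≡ c₂
    T₂-c₄       : RootedTree.parent T₂ c₄ ≡ c₃
    T₂-c₁       : RootedTree.parent T₂ c₁ ≡ c₄
    chord₁₃     : adj (Tree.graph T₁ ∪ Tree.graph T₂) c₁ c₃ ≡ false
    chord₂₄     : adj (Tree.graph T₁ ∪ Tree.graph T₂) c₂ c₄ ≡ false
    shared      : ∀ x y → Adj (common (Tree.graph T₁) (Tree.graph T₂)) x y →
                  SameEdge x y c₂ c₃ ⊎ SameEdge x y c₃ c₄
    degrees     : ∀ x → degree (Tree.graph T₁ ∪ Tree.graph T₂) x ≡ d x

module FromCertificate {A : VertexSet N} {d : Fin N → ℕ} (C : Certificate A d) where
  open Certificate C
  open Distinct₄ distinct
  module T₁ = Tree T₁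
  module T₂ = Tree T₂

  G S : Graph N
  G = T₁.graph ∪ T₂.graph
  S = common T₁.graph T₂.graph

  private
    ⊆-∪ˡ : Subgraph T₁.graph G
    ⊆-∪ˡ x y l rewrite l = refl

    ⊆-∪ʳ : Subgraph T₂.graph G
    ⊆-∪ʳ x y l rewrite l = ∨-zeroʳ _

    c₁∈ : c₁ ∈ A
    c₁∈ = RootedTree.root∈ T₁

    c₂∈ : c₂ ∈ A
    c₂∈ = RootedTree.root∈ T₂

    c₂c₃ : T₁.Child c₃ c₂
    c₂c₃ = ∈-─ A c₁ c₃∈ (≢₁₃ ∘ sym) , T₁-c₃

    c₃c₄ : T₁.Child c₄ c₃
    c₃c₄ = ∈-─ A c₁ c₄∈ (≢₁₄ ∘ sym) , T₁-c₄

    c₂c₃′ : T₂.Child c₃ c₂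
    c₂c₃′ = ∈-─ A c₂ c₃∈ (≢₂₃ ∘ sym) , T₂-c₃

    c₃c₄′ : T₂.Child c₄ c₃
    c₃c₄′ = ∈-─ A c₂ c₄∈ (≢₂₄ ∘ sym) , T₂-c₄

  induced : InducedC4 G c₁ c₂ c₃ c₄
  induced = Distinct₄⇒Unique distinct
          , ⊆-∪ˡ c₁ c₂ (T₁.link-parent (∈-─ A c₁ c₂∈ (≢₁₂ ∘ sym) , T₁-c₂))
          , ⊆-∪ˡ c₂ c₃ (T₁.link-parent c₂c₃)
          , ⊆-∪ˡ c₃ c₄ (T₁.link-parent c₃c₄)
          , ⊆-∪ʳ c₄ c₁ (T₂.link-parent (∈-─ A c₂ c₁∈ ≢₁₂ , T₂-c₁))
          , chord₁₃ , chord₂₄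

  spanning₁ : (∀ x → x ∈ A) → SpanningTree G T₁.graph
  spanning₁ full = ⊆-∪ˡ , T₁.connected full , T₁.acyclic

  spanning₂ : (∀ x → x ∈ A) → SpanningTree G T₂.graph
  spanning₂ full = ⊆-∪ʳ , T₂.connected full , T₂.acyclic

  private
    shared-link : {x y : Fin N} → T₁.Child y x → T₂.Child y x → Adj S x y
    shared-link c c′ rewrite T₁.link-parent c | T₂.link-parent c′ = refl

    degree-c₂ : degree S c₂ ≡ 1
    degree-c₂ = ∣∣≡1 {A = adj S c₂} (shared-link c₂c₃ c₂c₃′) only
      where
      only : ∀ y → Adj S c₂ y → y ≡ c₃
      only y s with shared c₂ y s
      ... | inj₁ e = SameEdge-end ≢₂₃ e refl
      ... | inj₂ e = ⊥-elim (¬SameEdgeˡ ≢₂₃ ≢₂₄ e)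

    degree-c₃ : degree S c₃ ≡ 2
    degree-c₃ = ∣∣≡2 {A = adj S c₃} ≢₂₄ (trans (Graph.sym S c₃ c₂) (shared-link c₂c₃ c₂c₃′))
                                        (shared-link c₃c₄ c₃c₄′) only
      where
      only : ∀ y → Adj S c₃ y → y ≡ c₂ ⊎ y ≡ c₄
      only y s with shared c₃ y s
      ... | inj₁ e = inj₁ (SameEdge-end (≢₂₃ ∘ sym) (SameEdge-swap e) refl)
      ... | inj₂ e = inj₂ (SameEdge-end ≢₃₄ e refl)

    degree-c₄ : degree S c₄ ≡ 1
    degree-c₄ = ∣∣≡1 {A = adj S c₄} (trans (Graph.sym S c₄ c₃) (shared-link c₃c₄ c₃c₄′)) only
      where
      only : ∀ y → Adj S c₄ y → y ≡ c₃
      only y s with shared c₄ y s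
      ... | inj₁ e = ⊥-elim (¬SameEdgeˡ (≢₂₄ ∘ sym) (≢₃₄ ∘ sym) e)
      ... | inj₂ e = SameEdge-end (≢₃₄ ∘ sym) (SameEdge-swap e) refl

    degree-other : ∀ {x} → x ≢ c₂ → x ≢ c₃ → x ≢ c₄ → degree S x ≡ 0
    degree-other {x} x≢c₂ x≢c₃ x≢c₄ = ∣∣≡0 {A = adj S x} λ y → ¬-not λ s → none y s
      where
      none : ∀ y → Adj S x y → ⊥
      none y s with shared x y s
      ... | inj₁ e = ¬SameEdgeˡ x≢c₂ x≢c₃ e
      ... | inj₂ e = ¬SameEdgeˡ x≢c₃ x≢c₄ e

  shared-degree : ∀ x → degree S x ≡ (δ c₂ x + δ c₃ x) + (δ c₃ x + δ c₄ x)
  shared-degree x = by-cases (x ≟ c₂) (x ≟ c₃) (x ≟ c₄)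
    where
    by-cases : Dec (x ≡ c₂) → Dec (x ≡ c₃) → Dec (x ≡ c₄) → degree S x ≡ (δ c₂ x + δ c₃ x) + (δ c₃ x + δ c₄ x)
    by-cases (yes refl) _ _ = trans degree-c₂
      (sym (cong₂ _+_ (cong₂ _+_ (δ-same c₂) (δ-other ≢₂₃)) (cong₂ _+_ (δ-other ≢₂₃) (δ-other ≢₂₄))))
    by-cases (no x≢c₂) (yes refl) _ = trans degree-c₃
      (sym (cong₂ _+_ (cong₂ _+_ (δ-other x≢c₂) (δ-same c₃)) (cong₂ _+_ (δ-same c₃) (δ-other ≢₃₄))))
    by-cases (no x≢c₂) (no x≢c₃) (yes refl) = trans degree-c₄
      (sym (cong₂ _+_ (cong₂ _+_ (δ-other x≢c₂) (δ-other x≢c₃)) (cong₂ _+_ (δ-other x≢c₃) (δ-same c₄))))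
    by-cases (no x≢c₂) (no x≢c₃) (no x≢c₄) = trans (degree-other x≢c₂ x≢c₃ x≢c₄)
      (sym (cong₂ _+_ (cong₂ _+_ (δ-other x≢c₂) (δ-other x≢c₃)) (cong₂ _+_ (δ-other x≢c₃) (δ-other x≢c₄))))

  shared-edges : edgeCount S ≡ 2
  shared-edges = *-cancelˡ-≡ _ _ 2 (begin
    2 * edgeCount S                                          ≡⟨ handshake S ⟩
    ∑ (degree S)                                             ≡⟨ sum-cong-≗ shared-degree ⟩
    ∑ (λ x → (δ c₂ x + δ c₃ x) + (δ c₃ x + δ c₄ x))          ≡⟨ ∑-distrib-+ (λ x → δ c₂ x + δ c₃ x) (λ x → δ c₃ x + δ c₄ x) ⟩
    ∑ (λ x → δ c₂ x + δ c₃ x) + ∑ (λ x → δ c₃ x + δ c₄ x)    ≡⟨ cong₂ _+_ (∑-pair c₂ c₃) (∑-pair c₃ c₄) ⟩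
    2 * 2                                                    ∎)
    where
    open ≡-Reasoning
    ∑-pair : ∀ p q → ∑ (λ x → δ p x + δ q x) ≡ 2
    ∑-pair p q = trans (∑-distrib-+ (δ p) (δ q)) (cong₂ _+_ (∑-δ p) (∑-δ q))

  shared⊆C4 : ∀ i j → Adj S i j → EdgeOfC4 c₁ c₂ c₃ c₄ i j
  shared⊆C4 i j s with shared i j s
  ... | inj₁ e = inj₂ (inj₁ e)
  ... | inj₂ e = inj₂ (inj₂ (inj₁ e))

  realizes : Realization d G
  realizes x = trans (deg≡degree G x) (degrees x)

  edges : 2 * edgeCount G ≡ ∑ d
  edges = trans (handshake G) (sum-cong-≗ degrees)

-- Adding a vertex of degree 2 or 3

module Extension {A : VertexSet N} {v : Fin N} (v∈A : v ∈ A) {d′ : Fin N → ℕ} (C : Certificate (A ─ v) d′) where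
  open Certificate C public
  open Distinct₄ distinct public
  module T₁ = Tree T₁
  module T₂ = Tree T₂

  G : Graph N
  G = T₁.graph ∪ T₂.graph

  ≢v : {x : Fin N} → x ∈ A ─ v → x ≢ v
  ≢v = ─-≢v A v

  c₁≢v : c₁ ≢ v
  c₁≢v = ≢v (RootedTree.root∈ T₁)

  c₂≢v : c₂ ≢ v
  c₂≢v = ≢v (RootedTree.root∈ T₂)

  c₃≢v : c₃ ≢ v
  c₃≢v = ≢v c₃∈

  c₄≢v : c₄ ≢ v
  c₄≢v = ≢v c₄∈

  G-v : (y : Fin N) → adj G v y ≡ false
  G-v y = cong₂ _∨_ (T₁.link-∉ (v∉─v A v) y) (T₂.link-∉ (v∉─v A v) y)

  to-v : (x : Fin N) → adj G x v ≡ false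
  to-v x = trans (Graph.sym G x v) (G-v x)

  d′-v : d′ v ≡ 0
  d′-v = trans (sym (degrees v)) (∣∣≡0 {A = adj G v} G-v)

module AddLeaves {A : VertexSet N} {v : Fin N} (v∈A : v ∈ A) {d′ : Fin N → ℕ} (C : Certificate (A ─ v) d′)
                 {a b : Fin N} (a∈ : a ∈ A ─ v) (b∈ : b ∈ A ─ v) (a≢b : a ≢ b) where
  open Extension v∈A C
  module L₁ = AttachLeaf v∈A T₁ a∈
  module L₂ = AttachLeaf v∈A T₂ b∈

  G′ : Graph N
  G′ = L₁.New.graph ∪ L₂.New.graph

  G′-≢ : {x y : Fin N} → x ≢ v → y ≢ v → adj G′ x y ≡ adj G x y
  G′-≢ x≢v y≢v = cong₂ _∨_ (L₁.link-≢ x≢v y≢v) (L₂.link-≢ x≢v y≢v)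

  G′-v : (y : Fin N) → adj G′ v y ≡ (y == a) ∨ (y == b)
  G′-v y = cong₂ _∨_ (L₁.link-v y) (L₂.link-v y)

  degree-v : degree G′ v ≡ 2
  degree-v = ∣∣≡2 {A = adj G′ v} a≢b (trans (G′-v a) (cong (_∨ (a == b)) (==-refl a)))
                                     (trans (G′-v b) (trans (cong ((b == a) ∨_) (==-refl b)) (∨-zeroʳ _))) only
    where
    only : ∀ y → adj G′ v y ≡ true → y ≡ a ⊎ y ≡ b
    only y e with ∨-≡true (trans (sym (G′-v y)) e)
    ... | inj₁ y≡a = inj₁ (==-sound y≡a)
    ... | inj₂ y≡b = inj₂ (==-sound y≡b)

  degree-≢ : {x : Fin N} → x ≢ v → degree G′ x ≡ degree G x + (δ a x + δ b x)
  degree-≢ {x} x≢v = trans (degree-extend {G = G} {G′ = G′} (λ y y≢v → G′-≢ x≢v y≢v) (to-v x)) (cong (degree G x +_) edge-to-v)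
    where
    edge-to-v : b2n (adj G′ x v) ≡ δ a x + δ b x
    edge-to-v = trans (cong b2n (trans (Graph.sym G′ x v) (G′-v x)))
                      (b2n-∨ {P = x == a} λ x≡a → trans (cong (_== b) (==-sound {x = x} {y = a} x≡a)) (==-≢ a≢b))

  leaf-ends : ∀ y → L₁.New.link v y ≡ true → L₂.New.link v y ≡ true → a ≡ b
  leaf-ends y l₁ l₂ = trans (sym (==-sound {x = y} (trans (sym (L₁.link-v y)) l₁))) (==-sound (trans (sym (L₂.link-v y)) l₂))

  shared′ : ∀ x y → Adj (common L₁.New.graph L₂.New.graph) x y → SameEdge x y c₂ c₃ ⊎ SameEdge x y c₃ c₄
  shared′ x y s with x ≟ v | y ≟ v
  ... | yes refl | _ = ⊥-elim (a≢b (leaf-ends y (∧-conicalˡ _ _ s) (∧-conicalʳ _ _ s)))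
  ... | no x≢v | yes refl = ⊥-elim (a≢b (leaf-ends x (trans (L₁.New.link-sym v x) (∧-conicalˡ _ _ s))
                                                     (trans (L₂.New.link-sym v x) (∧-conicalʳ _ _ s))))
  ... | no x≢v | no y≢v = shared x y (subst₂ (λ p q → p ∧ q ≡ true) (L₁.link-≢ x≢v y≢v) (L₂.link-≢ x≢v y≢v) s)

  certificate : (d : Fin N → ℕ) → (∀ x → d x ≡ d′ x + (δ a x + δ b x + 2 * δ v x)) → Certificate A d
  certificate d d≡ = record
    { c₁ = c₁ ; c₂ = c₂ ; c₃ = c₃ ; c₄ = c₄
    ; distinct = distinct
    ; c₃∈ = ─-⊆ A v c₃∈
    ; c₄∈ = ─-⊆ A v c₄∈
    ; T₁ = L₁.tree
    ; T₂ = L₂.tree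
    ; T₁-c₂ = trans (≔-other _ a c₂≢v) T₁-c₂
    ; T₁-c₃ = trans (≔-other _ a c₃≢v) T₁-c₃
    ; T₁-c₄ = trans (≔-other _ a c₄≢v) T₁-c₄
    ; T₂-c₃ = trans (≔-other _ b c₃≢v) T₂-c₃
    ; T₂-c₄ = trans (≔-other _ b c₄≢v) T₂-c₄
    ; T₂-c₁ = trans (≔-other _ b c₁≢v) T₂-c₁
    ; chord₁₃ = trans (G′-≢ c₁≢v c₃≢v) chord₁₃
    ; chord₂₄ = trans (G′-≢ c₂≢v c₄≢v) chord₂₄
    ; shared = shared′
    ; degrees = degrees′ }
    where
    degrees′ : ∀ x → degree G′ x ≡ d x
    degrees′ x with x ≟ v
    ... | yes refl = trans degree-v (sym (trans (d≡ v) (cong₂ _+_ d′-v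
                       (cong₂ _+_ (cong₂ _+_ (δ-other (≢v a∈ ∘ sym)) (δ-other (≢v b∈ ∘ sym))) (cong (2 *_) (δ-same v))))))
    ... | no x≢v = trans (degree-≢ x≢v) (trans (cong (_+ (δ a x + δ b x)) (degrees x))
                     (sym (trans (d≡ x) (cong (d′ x +_) (trans (cong (λ t → δ a x + δ b x + 2 * t) (δ-other x≢v))
                                                                  (+-identityʳ _))))))

-- A non-root vertex  x₀  of the first tree such that subdividing its edge to the parent
-- and attaching the new vertex to  a  in the second tree keeps the certificate valid.
record SubdivisionSite {A : VertexSet N} {d : Fin N → ℕ} (C : Certificate A d) (a : Fin N) : Set where
  open Certificate C
  field
    x₀    : Fin N
    x₀∈   : x₀ ∈ A ─ c₁
    x₀≢a  : x₀ ≢ a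
    p≢a   : RootedTree.parent T₁ x₀ ≢ a
    x₀≢c₂ : x₀ ≢ c₂
    x₀≢c₃ : x₀ ≢ c₃
    x₀≢c₄ : x₀ ≢ c₄

module SubdivideAndAttach {A : VertexSet N} {v : Fin N} (v∈A : v ∈ A) {d′ : Fin N → ℕ}
                          (C : Certificate (A ─ v) d′) {a : Fin N} (a∈ : a ∈ A ─ v)
                          (site : SubdivisionSite C a) where
  open Extension v∈A C
  open SubdivisionSite site
  module S₁ = Subdivide v∈A T₁ x₀∈
  module L₂ = AttachLeaf v∈A T₂ a∈
  open S₁ using (c; c≢v; x₀≢v; c≢x₀)

  G′ : Graph N
  G′ = S₁.New.graph ∪ L₂.New.graph

  G′-v : (y : Fin N) → adj G′ v y ≡ ((y == c) ∨ (y == x₀)) ∨ (y == a)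
  G′-v y = cong₂ _∨_ (S₁.link-v y) (L₂.link-v y)

  G′-other : {x y : Fin N} → x ≢ v → y ≢ v → ¬ SameEdge x y x₀ c → adj G′ x y ≡ adj G x y
  G′-other x≢v y≢v ¬e = cong₂ _∨_ (S₁.link-other x≢v y≢v ¬e) (L₂.link-≢ x≢v y≢v)

  T₂-x₀c : T₂.link x₀ c ≡ false
  T₂-x₀c with T₂.link x₀ c in l
  ... | false = refl
  ... | true with shared x₀ c (cong₂ _∧_ S₁.old-link-x₀c l)
  ...   | inj₁ e = ⊥-elim (¬SameEdgeˡ x₀≢c₂ x₀≢c₃ e)
  ...   | inj₂ e = ⊥-elim (¬SameEdgeˡ x₀≢c₃ x₀≢c₄ e)

  G′-x₀c : adj G′ x₀ c ≡ false
  G′-x₀c = cong₂ _∨_ S₁.link-x₀c (trans (L₂.link-≢ x₀≢v c≢v) T₂-x₀c)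

  G-x₀c : adj G x₀ c ≡ true
  G-x₀c rewrite S₁.old-link-x₀c = refl

  degree-v : degree G′ v ≡ 3
  degree-v = trans (sum-cong-≗ (λ y → cong b2n (G′-v y))) ∣⁅ c≢x₀ , p≢a , x₀≢a ⁆∣

  G′-to-v : (x : Fin N) → adj G′ x v ≡ ((x == c) ∨ (x == x₀)) ∨ (x == a)
  G′-to-v x = trans (Graph.sym G′ x v) (G′-v x)

  degree-x₀ : degree G′ x₀ ≡ degree G x₀
  degree-x₀ = degree-reroute {G = G} {G′ = G′} (c≢v ∘ sym)
    (λ y y≢v y≢c → G′-other x₀≢v y≢v (¬SameEdge-off (c≢x₀ ∘ sym) y≢c ∘ SameEdge-swap))
    (to-v x₀) G-x₀c
    (trans (G′-to-v x₀) (trans (cong (λ b → ((x₀ == c) ∨ b) ∨ (x₀ == a)) (==-refl x₀)) (cong (_∨ (x₀ == a)) (∨-zeroʳ _))))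
    G′-x₀c

  degree-c : degree G′ c ≡ degree G c
  degree-c = degree-reroute {G = G} {G′ = G′} (x₀≢v ∘ sym)
    (λ y y≢v y≢x₀ → G′-other c≢v y≢v (¬SameEdge-off c≢x₀ y≢x₀))
    (to-v c) (trans (Graph.sym G c x₀) G-x₀c)
    (trans (G′-to-v c) (cong (λ b → (b ∨ (c == x₀)) ∨ (c == a)) (==-refl c)))
    (trans (Graph.sym G′ c x₀) G′-x₀c)

  degree-far : {x : Fin N} → x ≢ v → x ≢ x₀ → x ≢ c → degree G′ x ≡ degree G x + δ a x
  degree-far {x} x≢v x≢x₀ x≢c = trans
    (degree-extend {G = G} {G′ = G′} (λ y y≢v → G′-other x≢v y≢v (¬SameEdgeˡ x≢x₀ x≢c)) (to-v x))
    (cong (λ b → degree G x + b2n b) (trans (G′-to-v x) (cong₂ (λ p q → (p ∨ q) ∨ (x == a)) (==-≢ x≢c) (==-≢ x≢x₀))))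

  degree-≢ : {x : Fin N} → x ≢ v → degree G′ x ≡ degree G x + δ a x
  degree-≢ {x} x≢v with x ≟ x₀ | x ≟ c
  ... | yes refl | _        = trans degree-x₀ (sym (trans (cong (degree G x₀ +_) (δ-other x₀≢a)) (+-identityʳ _)))
  ... | no _     | yes refl = trans degree-c (sym (trans (cong (degree G c +_) (δ-other p≢a)) (+-identityʳ _)))
  ... | no x≢x₀  | no x≢c   = degree-far x≢v x≢x₀ x≢c

  v-ends : ∀ y → S₁.New.link v y ≡ true → L₂.New.link v y ≡ true → ⊥
  v-ends y l₁ l₂ with ∨-≡true {P = y == c} (trans (sym (S₁.link-v y)) l₁) | ==-sound {x = y} (trans (sym (L₂.link-v y)) l₂)
  ... | inj₁ y≡c  | refl = p≢a (sym (==-sound y≡c))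
  ... | inj₂ y≡x₀ | refl = x₀≢a (sym (==-sound y≡x₀))

  shared′ : ∀ x y → Adj (common S₁.New.graph L₂.New.graph) x y → SameEdge x y c₂ c₃ ⊎ SameEdge x y c₃ c₄
  shared′ x y s with x ≟ v | y ≟ v | SameEdge? x y x₀ c
  ... | yes refl | _ | _ = ⊥-elim (v-ends y (∧-conicalˡ _ _ s) (∧-conicalʳ _ _ s))
  ... | no _ | yes refl | _ = ⊥-elim (v-ends x (trans (S₁.New.link-sym v x) (∧-conicalˡ _ _ s))
                                                (trans (L₂.New.link-sym v x) (∧-conicalʳ _ _ s)))
  ... | no _ | no _ | yes (inj₁ (refl , refl)) = ⊥-elim (not-¬ (∧-conicalˡ _ _ s) S₁.link-x₀c)
  ... | no _ | no _ | yes (inj₂ (refl , refl)) =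
    ⊥-elim (not-¬ (∧-conicalˡ _ _ s) (trans (S₁.New.link-sym c x₀) S₁.link-x₀c))
  ... | no x≢v | no y≢v | no ¬e =
    shared x y (subst₂ (λ p q → p ∧ q ≡ true) (S₁.link-other x≢v y≢v ¬e) (L₂.link-≢ x≢v y≢v) s)

  certificate : (d : Fin N → ℕ) → (∀ x → d x ≡ d′ x + (δ a x + 3 * δ v x)) → Certificate A d
  certificate d d≡ = record
    { c₁ = c₁ ; c₂ = c₂ ; c₃ = c₃ ; c₄ = c₄
    ; distinct = distinct
    ; c₃∈ = ─-⊆ A v c₃∈
    ; c₄∈ = ─-⊆ A v c₄∈
    ; T₁ = S₁.tree
    ; T₂ = L₂.tree
    ; T₁-c₂ = trans (S₁.parent′-other c₂≢v (x₀≢c₂ ∘ sym)) T₁-c₂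
    ; T₁-c₃ = trans (S₁.parent′-other c₃≢v (x₀≢c₃ ∘ sym)) T₁-c₃
    ; T₁-c₄ = trans (S₁.parent′-other c₄≢v (x₀≢c₄ ∘ sym)) T₁-c₄
    ; T₂-c₃ = trans (≔-other _ a c₃≢v) T₂-c₃
    ; T₂-c₄ = trans (≔-other _ a c₄≢v) T₂-c₄
    ; T₂-c₁ = trans (≔-other _ a c₁≢v) T₂-c₁
    ; chord₁₃ = trans (G′-other c₁≢v c₃≢v (¬SameEdge-off (x₀≢c₁ ∘ sym) (x₀≢c₃ ∘ sym))) chord₁₃
    ; chord₂₄ = trans (G′-other c₂≢v c₄≢v (¬SameEdge-off (x₀≢c₂ ∘ sym) (x₀≢c₄ ∘ sym))) chord₂₄
    ; shared = shared′
    ; degrees = degrees′ }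
    where
    x₀≢c₁ : x₀ ≢ c₁
    x₀≢c₁ = ─-≢v (A ─ v) c₁ x₀∈
    degrees′ : ∀ x → degree G′ x ≡ d x
    degrees′ x with x ≟ v
    ... | yes refl = trans degree-v (sym (trans (d≡ v) (cong₂ _+_ d′-v
                       (cong₂ _+_ (δ-other (≢v a∈ ∘ sym)) (cong (3 *_) (δ-same v))))))
    ... | no x≢v = trans (degree-≢ x≢v) (trans (cong (_+ δ a x) (degrees x))
                     (sym (trans (d≡ x) (cong (d′ x +_) (trans (cong (λ t → δ a x + 3 * t) (δ-other x≢v))
                                                                  (+-identityʳ _))))))

-- The 4-cycle

Distinct₄-rotate : {a b c d : Fin N} → Distinct₄ a b c d → Distinct₄ b c d a
Distinct₄-rotate D = record
  { ≢₁₂ = ≢₂₃ ; ≢₁₃ = ≢₂₄ ; ≢₁₄ = ≢₁₂ ∘ sym ; ≢₂₃ = ≢₃₄ ; ≢₂₄ = ≢₁₃ ∘ sym ; ≢₃₄ = ≢₁₄ ∘ sym }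
  where open Distinct₄ D

EdgeOfC4-rotate : {a b c d x y : Fin N} → EdgeOfC4 a b c d x y → EdgeOfC4 b c d a x y
EdgeOfC4-rotate (inj₁ e)               = inj₂ (inj₂ (inj₂ e))
EdgeOfC4-rotate (inj₂ (inj₁ e))        = inj₁ e
EdgeOfC4-rotate (inj₂ (inj₂ (inj₁ e))) = inj₂ (inj₁ e)
EdgeOfC4-rotate (inj₂ (inj₂ (inj₂ e))) = inj₂ (inj₂ (inj₁ e))

module _ {G : Graph N} {a b c d : Fin N} (D : Distinct₄ a b c d)
         (edges : ∀ x y → Adj G x y → EdgeOfC4 a b c d x y) where
  open Distinct₄ D

  C4-degree : Adj G a b → Adj G d a → degree G a ≡ 2
  C4-degree ab da = ∣∣≡2 {A = adj G a} ≢₂₄ ab (trans (Graph.sym G a d) da) neighbours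
    where
    neighbours : ∀ y → Adj G a y → y ≡ b ⊎ y ≡ d
    neighbours y a~y with edges a y a~y
    ... | inj₁ e               = inj₁ (SameEdge-end ≢₁₂ e refl)
    ... | inj₂ (inj₁ e)        = ⊥-elim (¬SameEdgeˡ ≢₁₂ ≢₁₃ e)
    ... | inj₂ (inj₂ (inj₁ e)) = ⊥-elim (¬SameEdgeˡ ≢₁₃ ≢₁₄ e)
    ... | inj₂ (inj₂ (inj₂ e)) = inj₂ (SameEdge-end ≢₁₄ (SameEdge-swap e) refl)

  C4-chord : adj G a c ≡ false
  C4-chord = ¬-not λ a~c → case (edges a c a~c)
    where
    case : EdgeOfC4 a b c d a c → ⊥
    case (inj₁ e)               = ≢₂₃ (sym (SameEdge-end ≢₁₂ e refl))
    case (inj₂ (inj₁ e))        = ¬SameEdgeˡ ≢₁₂ ≢₁₃ e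
    case (inj₂ (inj₂ (inj₁ e))) = ¬SameEdgeˡ ≢₁₃ ≢₁₄ e
    case (inj₂ (inj₂ (inj₂ e))) = ≢₃₄ (SameEdge-end ≢₁₄ (SameEdge-swap e) refl)

rotate : {A : VertexSet N} → Enumeration₄ A → Enumeration₄ A
rotate E = record
  { c₁ = c₂ ; c₂ = c₃ ; c₃ = c₄ ; c₄ = c₁
  ; distinct = Distinct₄-rotate distinct
  ; c₁∈ = c₂∈ ; c₂∈ = c₃∈ ; c₃∈ = c₄∈ ; c₄∈ = c₁∈
  ; exhaustive = λ y y∈ → shift (exhaustive y y∈) }
  where
  open Enumeration₄ E
  shift : ∀ {y} → y ≡ c₁ ⊎ y ≡ c₂ ⊎ y ≡ c₃ ⊎ y ≡ c₄ → y ≡ c₂ ⊎ y ≡ c₃ ⊎ y ≡ c₄ ⊎ y ≡ c₁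
  shift (inj₁ e)               = inj₂ (inj₂ (inj₂ e))
  shift (inj₂ (inj₁ e))        = inj₁ e
  shift (inj₂ (inj₂ (inj₁ e))) = inj₂ (inj₁ e)
  shift (inj₂ (inj₂ (inj₂ e))) = inj₂ (inj₂ (inj₁ e))

module PathTree {A : VertexSet N} (E : Enumeration₄ A) where
  open Enumeration₄ E
  open Distinct₄ distinct

  along : {X : Set} → X → X → X → X → Fin N → X
  along α₁ α₂ α₃ α₄ x = if x == c₂ then α₂ else if x == c₃ then α₃ else if x == c₄ then α₄ else α₁

  module _ {X : Set} (α₁ α₂ α₃ α₄ : X) where
    along-c₁ : along α₁ α₂ α₃ α₄ c₁ ≡ α₁
    along-c₁ rewrite ==-≢ ≢₁₂ | ==-≢ ≢₁₃ | ==-≢ ≢₁₄ = refl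

    along-c₂ : along α₁ α₂ α₃ α₄ c₂ ≡ α₂
    along-c₂ rewrite ==-refl c₂ = refl

    along-c₃ : along α₁ α₂ α₃ α₄ c₃ ≡ α₃
    along-c₃ rewrite ==-≢ (≢₂₃ ∘ sym) | ==-refl c₃ = refl

    along-c₄ : along α₁ α₂ α₃ α₄ c₄ ≡ α₄
    along-c₄ rewrite ==-≢ (≢₂₄ ∘ sym) | ==-≢ (≢₃₄ ∘ sym) | ==-refl c₄ = refl

  nonroot : {x : Fin N} → x ∈ A ─ c₁ → x ≡ c₂ ⊎ x ≡ c₃ ⊎ x ≡ c₄
  nonroot {x} x∈ with exhaustive x (─-⊆ A c₁ x∈)
  ... | inj₁ x≡c₁ = ⊥-elim (─-≢v A c₁ x∈ x≡c₁)
  ... | inj₂ rest = rest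

  tree : RootedTree A c₁
  tree = record
    { parent       = along c₁ c₁ c₂ c₃
    ; height       = along 0 1 2 3
    ; root∈        = c₁∈
    ; parent∈      = parent∈
    ; parent-lower = parent-lower }
    where
    parent∈ : ∀ x → x ∈ A ─ c₁ → along c₁ c₁ c₂ c₃ x ∈ A
    parent∈ x x∈ with nonroot x∈
    ... | inj₁ refl        = trans (cong A (along-c₂ c₁ c₁ c₂ c₃)) c₁∈
    ... | inj₂ (inj₁ refl) = trans (cong A (along-c₃ c₁ c₁ c₂ c₃)) c₂∈
    ... | inj₂ (inj₂ refl) = trans (cong A (along-c₄ c₁ c₁ c₂ c₃)) c₃∈
    parent-lower : ∀ x → x ∈ A ─ c₁ → along 0 1 2 3 (along c₁ c₁ c₂ c₃ x) < along 0 1 2 3 x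
    parent-lower x x∈ with nonroot x∈
    ... | inj₁ refl        rewrite along-c₂ c₁ c₁ c₂ c₃ | along-c₂ 0 1 2 3 | along-c₁ 0 1 2 3 = s≤s z≤n
    ... | inj₂ (inj₁ refl) rewrite along-c₃ c₁ c₁ c₂ c₃ | along-c₃ 0 1 2 3 | along-c₂ 0 1 2 3 = s≤s (s≤s z≤n)
    ... | inj₂ (inj₂ refl) rewrite along-c₄ c₁ c₁ c₂ c₃ | along-c₄ 0 1 2 3 | along-c₃ 0 1 2 3 = s≤s (s≤s (s≤s z≤n))

  open Tree tree using (Child; link; link-elim)

  child₂ : Child c₂ c₁
  child₂ = ∈-─ A c₁ c₂∈ (≢₁₂ ∘ sym) , along-c₂ c₁ c₁ c₂ c₃

  child₃ : Child c₃ c₂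
  child₃ = ∈-─ A c₁ c₃∈ (≢₁₃ ∘ sym) , along-c₃ c₁ c₁ c₂ c₃

  child₄ : Child c₄ c₃
  child₄ = ∈-─ A c₁ c₄∈ (≢₁₄ ∘ sym) , along-c₄ c₁ c₁ c₂ c₃

  path-edges : ∀ {x y} → link x y ≡ true → SameEdge x y c₁ c₂ ⊎ SameEdge x y c₂ c₃ ⊎ SameEdge x y c₃ c₄
  path-edges l with link-elim l
  ... | inj₁ (x∈ , px≡y) with nonroot x∈
  ...   | inj₁ refl        = inj₁ (inj₂ (refl , trans (sym px≡y) (along-c₂ c₁ c₁ c₂ c₃)))
  ...   | inj₂ (inj₁ refl) = inj₂ (inj₁ (inj₂ (refl , trans (sym px≡y) (along-c₃ c₁ c₁ c₂ c₃))))
  ...   | inj₂ (inj₂ refl) = inj₂ (inj₂ (inj₂ (refl , trans (sym px≡y) (along-c₄ c₁ c₁ c₂ c₃))))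
  path-edges l | inj₂ (y∈ , py≡x) with nonroot y∈
  ...   | inj₁ refl        = inj₁ (inj₁ (trans (sym py≡x) (along-c₂ c₁ c₁ c₂ c₃) , refl))
  ...   | inj₂ (inj₁ refl) = inj₂ (inj₁ (inj₁ (trans (sym py≡x) (along-c₃ c₁ c₁ c₂ c₃) , refl)))
  ...   | inj₂ (inj₂ refl) = inj₂ (inj₂ (inj₁ (trans (sym py≡x) (along-c₄ c₁ c₁ c₂ c₃) , refl)))

module FourCycle {A : VertexSet N} (E : Enumeration₄ A) where
  open Enumeration₄ E
  module P = PathTree E
  module Q = PathTree (rotate E)

  G : Graph N
  G = Tree.graph P.tree ∪ Tree.graph Q.tree

  edges : ∀ x y → Adj G x y → EdgeOfC4 c₁ c₂ c₃ c₄ x y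
  edges x y x~y with ∨-≡true x~y
  ... | inj₁ l with P.path-edges l
  ...   | inj₁ e        = inj₁ e
  ...   | inj₂ (inj₁ e) = inj₂ (inj₁ e)
  ...   | inj₂ (inj₂ e) = inj₂ (inj₂ (inj₁ e))
  edges x y x~y | inj₂ l with Q.path-edges l
  ...   | inj₁ e        = inj₂ (inj₁ e)
  ...   | inj₂ (inj₁ e) = inj₂ (inj₂ (inj₁ e))
  ...   | inj₂ (inj₂ e) = inj₂ (inj₂ (inj₂ e))

  shared : ∀ x y → Adj (common (Tree.graph P.tree) (Tree.graph Q.tree)) x y →
           SameEdge x y c₂ c₃ ⊎ SameEdge x y c₃ c₄
  shared x y s with P.path-edges (∧-conicalˡ _ _ s) | Q.path-edges (∧-conicalʳ _ _ s)
  ... | inj₂ e | _ = e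
  ... | inj₁ _ | inj₁ e = inj₁ e
  ... | inj₁ _ | inj₂ (inj₁ e) = inj₂ e
  ... | inj₁ e | inj₂ (inj₂ e′) = ⊥-elim (Distinct₄.≢₂₄ distinct (SameEdge-unique e e′))

  private
    ∪ˡ : ∀ {x y} → Tree.link P.tree x y ≡ true → Adj G x y
    ∪ˡ l rewrite l = refl

    ∪ʳ : ∀ {x y} → Tree.link Q.tree x y ≡ true → Adj G x y
    ∪ʳ l rewrite l = ∨-zeroʳ _

  c₁~c₂ : Adj G c₁ c₂
  c₁~c₂ = ∪ˡ (Tree.link-parent P.tree P.child₂)

  c₂~c₃ : Adj G c₂ c₃
  c₂~c₃ = ∪ˡ (Tree.link-parent P.tree P.child₃)

  c₃~c₄ : Adj G c₃ c₄
  c₃~c₄ = ∪ˡ (Tree.link-parent P.tree P.child₄)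

  c₄~c₁ : Adj G c₄ c₁
  c₄~c₁ = ∪ʳ (Tree.link-parent Q.tree Q.child₄)

  D₁ : Distinct₄ c₂ c₃ c₄ c₁
  D₁ = Distinct₄-rotate distinct

  D₂ : Distinct₄ c₃ c₄ c₁ c₂
  D₂ = Distinct₄-rotate D₁

  D₃ : Distinct₄ c₄ c₁ c₂ c₃
  D₃ = Distinct₄-rotate D₂

  edges₁ : ∀ x y → Adj G x y → EdgeOfC4 c₂ c₃ c₄ c₁ x y
  edges₁ x y = EdgeOfC4-rotate ∘ edges x y

  edges₂ : ∀ x y → Adj G x y → EdgeOfC4 c₃ c₄ c₁ c₂ x y
  edges₂ x y = EdgeOfC4-rotate ∘ edges₁ x y

  edges₃ : ∀ x y → Adj G x y → EdgeOfC4 c₄ c₁ c₂ c₃ x y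
  edges₃ x y = EdgeOfC4-rotate ∘ edges₂ x y

  degree-∈ : ∀ x → x ∈ A → degree G x ≡ 2
  degree-∈ x x∈A with exhaustive x x∈A
  ... | inj₁ refl               = C4-degree {G = G} distinct edges c₁~c₂ c₄~c₁
  ... | inj₂ (inj₁ refl)        = C4-degree {G = G} D₁ edges₁ c₂~c₃ c₁~c₂
  ... | inj₂ (inj₂ (inj₁ refl)) = C4-degree {G = G} D₂ edges₂ c₃~c₄ c₂~c₃
  ... | inj₂ (inj₂ (inj₂ refl)) = C4-degree {G = G} D₃ edges₃ c₄~c₁ c₃~c₄

  degree-∉ : ∀ x → x ∉ A → degree G x ≡ 0
  degree-∉ x x∉A = ∣∣≡0 {A = adj G x} λ y → cong₂ _∨_ (Tree.link-∉ P.tree x∉A y) (Tree.link-∉ Q.tree x∉A y)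

  certificate : {d : Fin N → ℕ} → (∀ x → x ∈ A → d x ≡ 2) → (∀ x → x ∉ A → d x ≡ 0) → Certificate A d
  certificate {d} d-in d-out = record
    { c₁ = c₁ ; c₂ = c₂ ; c₃ = c₃ ; c₄ = c₄
    ; distinct = distinct
    ; c₃∈ = c₃∈ ; c₄∈ = c₄∈
    ; T₁ = P.tree ; T₂ = Q.tree
    ; T₁-c₂ = proj₂ P.child₂ ; T₁-c₃ = proj₂ P.child₃ ; T₁-c₄ = proj₂ P.child₄
    ; T₂-c₃ = proj₂ Q.child₂ ; T₂-c₄ = proj₂ Q.child₃ ; T₂-c₁ = proj₂ Q.child₄
    ; chord₁₃ = C4-chord {G = G} distinct edges
    ; chord₂₄ = C4-chord {G = G} D₁ edges₁
    ; shared = shared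
    ; degrees = degrees }
    where
    by-membership : ∀ x b → A x ≡ b → degree G x ≡ d x
    by-membership x true  x∈A = trans (degree-∈ x x∈A) (sym (d-in x x∈A))
    by-membership x false x∉A = trans (degree-∉ x x∉A) (sym (d-out x x∉A))
    degrees : ∀ x → degree G x ≡ d x
    degrees x = by-membership x (A x) refl

-- The induction

record Admissible (A : VertexSet N) (d : Fin N → ℕ) (k : ℕ) : Set where
  field
    size    : ∣ A ∣ ≡ k
    outside : ∀ x → x ∉ A → d x ≡ 0
    lower   : ∀ x → x ∈ A → 2 ≤ d x
    upper   : ∀ x → x ∈ A → d x + 2 ≤ k
    total   : ∑ d + 8 ≡ 4 * k

m≡n+1+o⇒m≰n : ∀ {m n} o → m ≡ n + suc o → m ≤ n → ⊥
m≡n+1+o⇒m≰n {m} {n} o m≡ m≤n = m+1+n≰m n (subst (_≤ n) m≡ m≤n)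

∑-∸ : (d w : Fin N → ℕ) → (∀ x → w x ≤ d x) → ∑ (λ x → d x ∸ w x) + ∑ w ≡ ∑ d
∑-∸ d w w≤d = trans (sym (∑-distrib-+ (λ x → d x ∸ w x) w)) (sum-cong-≗ λ x → m∸n+n≡m (w≤d x))

reduce : {A : VertexSet N} {d : Fin N → ℕ} {k : ℕ} → Admissible A d (5 + k) →
         {v : Fin N} → v ∈ A → (w : Fin N → ℕ) → (∀ x → w x ≤ d x) → w v ≡ d v → ∑ w ≡ 4 →
         (∀ x → x ∈ A ─ v → 2 ≤ d x ∸ w x) → (∀ x → x ∈ A ─ v → d x ∸ w x + 2 ≤ 4 + k) →
         Admissible (A ─ v) (λ x → d x ∸ w x) (4 + k)
reduce {A = A} {d} {k} adm {v} v∈A w w≤d wv≡dv ∑w≡4 lower′ upper′ = record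
  { size    = suc-injective (trans (sym (∣─∣ A v v∈A)) size)
  ; outside = outside′
  ; lower   = lower′
  ; upper   = upper′
  ; total   = +-cancelˡ-≡ 4 _ _ (begin
      4 + (∑ d′ + 8)       ≡⟨ solve 1 (λ s → con 4 :+ (s :+ con 8) := s :+ con 4 :+ con 8) refl (∑ d′) ⟩
      ∑ d′ + 4 + 8         ≡⟨ cong (λ t → ∑ d′ + t + 8) ∑w≡4 ⟨
      ∑ d′ + ∑ w + 8       ≡⟨ cong (_+ 8) (∑-∸ d w w≤d) ⟩
      ∑ d + 8              ≡⟨ total ⟩
      4 * (5 + k)          ≡⟨ *-suc 4 (4 + k) ⟩
      4 + 4 * (4 + k)      ∎) }
  where
  open Admissible adm
  open ≡-Reasoning
  d′ : Fin _ → ℕ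
  d′ x = d x ∸ w x
  outside′ : ∀ x → x ∉ A ─ v → d x ∸ w x ≡ 0
  outside′ x x∉ with x ≟ v
  ... | yes refl = trans (cong (d v ∸_) wv≡dv) (n∸n≡0 (d v))
  ... | no x≢v   = trans (cong (_∸ w x) (outside x (trans (sym (∧-identityʳ (A x))) x∉))) (0∸n≡0 (w x))

∑-weight : (m : ℕ) (a : Fin N) → ∑ (λ y → m * δ a y) ≡ m
∑-weight m a = trans (∑-scale m (δ a)) (trans (cong (m *_) (∑-δ a)) (*-identityʳ m))

∑-count : (c : ℕ) (A : VertexSet N) → ∑ (λ y → c * b2n (A y)) ≡ c * ∣ A ∣
∑-count c A = ∑-scale c (b2n ∘ A)

degree-sum : {A : VertexSet N} {d : Fin N → ℕ} {k : ℕ} → Admissible A d (5 + k) → ∑ d ≡ 12 + 4 * k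
degree-sum {d = d} {k} adm = +-cancelʳ-≡ 8 _ _
  (trans (Admissible.total adm) (solve 1 (λ k → con 4 :* (con 5 :+ k) := con 12 :+ con 4 :* k :+ con 8) refl k))

∑-lower : {A : VertexSet N} {d : Fin N → ℕ} (c : ℕ) → (∀ x → x ∈ A → c ≤ d x) → c * ∣ A ∣ ≤ ∑ d
∑-lower {A = A} {d} c c≤d = subst (_≤ ∑ d) (∑-count c A) (∑-mono-≤ pointwise)
  where
  pointwise : ∀ x → c * b2n (A x) ≤ d x
  pointwise x with A x in x∈A
  ... | true  = subst (_≤ d x) (sym (*-identityʳ c)) (c≤d x x∈A)
  ... | false = subst (_≤ d x) (sym (*-zeroʳ c)) z≤n

∑-upper : {A : VertexSet N} {d : Fin N → ℕ} (c : ℕ) → (∀ x → x ∈ A → d x ≤ c) → (∀ x → x ∉ A → d x ≡ 0) →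
          ∑ d ≤ c * ∣ A ∣
∑-upper {A = A} {d} c d≤c outside = subst (∑ d ≤_) (∑-count c A) (∑-mono-≤ pointwise)
  where
  pointwise : ∀ x → d x ≤ c * b2n (A x)
  pointwise x with A x in x∈A
  ... | true  = subst (d x ≤_) (sym (*-identityʳ c)) (d≤c x x∈A)
  ... | false = subst (_≤ c * 0) (sym (outside x x∈A)) z≤n

weighted-≤ : (c m : ℕ) {n : ℕ} (p q : Bool) → (p ≡ true → c ≤ n) → (q ≡ true → c + m ≤ n) →
             (q ≡ true → p ≡ true) → c * b2n p + m * b2n q ≤ n
weighted-≤ c m {n} true  true  _   c+m≤n _ =
  subst (_≤ n) (sym (cong₂ _+_ (*-identityʳ c) (*-identityʳ m))) (c+m≤n refl)
weighted-≤ c m {n} true  false c≤n _     _ =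
  subst (_≤ n) (sym (trans (cong₂ _+_ (*-identityʳ c) (*-zeroʳ m)) (+-identityʳ c))) (c≤n refl)
weighted-≤ c m {n} false false _   _     _ =
  subst (_≤ n) (sym (cong₂ _+_ (*-zeroʳ c) (*-zeroʳ m))) z≤n
weighted-≤ c m false true  _    _     q⇒p with () ← q⇒p refl

∑-weighted : {A S : VertexSet N} {d : Fin N → ℕ} (c m : ℕ) → (∀ y → c * b2n (A y) + m * b2n (S y) ≤ d y) →
             c * ∣ A ∣ + m * ∣ S ∣ ≤ ∑ d
∑-weighted {A = A} {S} {d} c m bound = subst (_≤ ∑ d)
  (trans (∑-distrib-+ (λ y → c * b2n (A y)) (λ y → m * b2n (S y))) (cong₂ _+_ (∑-count c A) (∑-count m S)))
  (∑-mono-≤ bound)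

bad-vertex-bound : ∀ n p q r s t → n ∧ (not p ∧ (not q ∧ (not r ∧ (not s ∧ not t)))) ≡ false →
                   b2n n ≤ b2n (n ∧ p) + (b2n (n ∧ q) + (b2n r + (b2n s + b2n t)))
bad-vertex-bound false _     _     _     _     _     _ = z≤n
bad-vertex-bound true  true  _     _     _     _     _ = s≤s z≤n
bad-vertex-bound true  false true  _     _     _     _ = s≤s z≤n
bad-vertex-bound true  false false true  _     _     _ = s≤s z≤n
bad-vertex-bound true  false false false true  _     _ = s≤s z≤n
bad-vertex-bound true  false false false false true  _ = s≤s z≤n

min-degree≤3 : {A : VertexSet N} {d : Fin N → ℕ} {k : ℕ} → Admissible A d (5 + k) →
               {v : Fin N} → (∀ x → x ∈ A → d v ≤ d x) → d v ≤ 3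
min-degree≤3 {d = d} {k} adm {v} v-min with d v ≤? 3
... | yes dv≤3 = dv≤3
... | no dv≰3 = ⊥-elim (m≡n+1+o⇒m≰n 7 (solve 1 (λ k → con 4 :* (con 5 :+ k) := con 12 :+ con 4 :* k :+ con 8) refl k)
                         (subst (4 * (5 + k) ≤_) (degree-sum adm)
                           (subst (λ s → 4 * s ≤ ∑ d) (Admissible.size adm)
                             (∑-lower 4 λ x x∈A → ≤-trans (≰⇒> dv≰3) (v-min x x∈A)))))

module DegreeTwo {A : VertexSet N} {d : Fin N → ℕ} {k : ℕ} (adm : Admissible A d (5 + k))
                 {v : Fin N} (v∈A : v ∈ A) (dv≡2 : d v ≡ 2)
                 {a : Fin N} (a∈ : a ∈ A ─ v) (a-max : ∀ x → x ∈ A ─ v → d x ≤ d a)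
                 {b : Fin N} (b∈ : b ∈ A ─ v ─ a) (b-max : ∀ x → x ∈ A ─ v ─ a → d x ≤ d b) where
  open Admissible adm

  a≢v : a ≢ v
  a≢v = ─-≢v A v a∈

  b≢a : b ≢ a
  b≢a = ─-≢v (A ─ v) a b∈

  b≢v : b ≢ v
  b≢v = ─-≢v A v (─-⊆ (A ─ v) a b∈)

  d≤3+k : ∀ x → x ∈ A → d x ≤ 3 + k
  d≤3+k x x∈A = +-cancelʳ-≤ 2 (d x) (3 + k) (subst (d x + 2 ≤_) (+-comm 2 (3 + k)) (upper x x∈A))

  3≤da : 3 ≤ d a
  3≤da with 3 ≤? d a
  ... | yes 3≤da = 3≤da
  ... | no 3≰da = ⊥-elim (m≡n+1+o⇒m≰n (1 + 2 * k)
      (solve 1 (λ k → con 12 :+ con 4 :* k := con 2 :* (con 5 :+ k) :+ (con 2 :+ con 2 :* k)) refl k)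
      (subst₂ _≤_ (degree-sum adm) (cong (2 *_) size) (∑-upper 2 bound outside)))
    where
    bound : ∀ x → x ∈ A → d x ≤ 2
    bound x x∈A with x ≟ v
    ... | yes refl = ≤-reflexive dv≡2
    ... | no x≢v   = ≤-trans (a-max x (∈-─ A v x∈A x≢v)) (≤-pred (≰⇒> 3≰da))

  3≤db : 3 ≤ d b
  3≤db with 3 ≤? d b
  ... | yes 3≤db = 3≤db
  ... | no 3≰db = ⊥-elim (m≡n+1+o⇒m≰n k
      (solve 1 (λ k → con 12 :+ con 4 :* k := con 2 :* (con 5 :+ k) :+ (con 1 :+ k) :+ (con 1 :+ k)) refl k)
      (subst₂ _≤_ (degree-sum adm) (cong₂ _+_ (trans (∑-count 2 A) (cong (2 *_) size)) (∑-weight (1 + k) a))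
        (subst (∑ d ≤_) (∑-distrib-+ (λ x → 2 * b2n (A x)) (λ x → (1 + k) * δ a x)) (∑-mono-≤ bound))))
    where
    at-most-2 : ∀ x → x ∈ A → x ≢ a → d x ≤ 2
    at-most-2 x x∈A x≢a with x ≟ v
    ... | yes refl = ≤-reflexive dv≡2
    ... | no x≢v   = ≤-trans (b-max x (∈-─ (A ─ v) a (∈-─ A v x∈A x≢v) x≢a)) (≤-pred (≰⇒> 3≰db))
    bound : ∀ x → d x ≤ 2 * b2n (A x) + (1 + k) * δ a x
    bound x with A x in x∈A | x ≟ a
    ... | false | _        = subst (_≤ _) (sym (outside x x∈A)) z≤n
    ... | true  | yes refl = subst (d x ≤_) (solve 1 (λ k → con 3 :+ k := con 2 :* con 1 :+ (con 1 :+ k) :* con 1) refl k)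
                                (d≤3+k x x∈A)
    ... | true  | no x≢a = ≤-trans (at-most-2 x x∈A x≢a) (m≤m+n 2 _)

  other-upper : ∀ x → x ∈ A ─ v ─ a ─ b → d x + 2 ≤ 4 + k
  other-upper x x∈ with d x + 2 ≤? 4 + k
  ... | yes fits = fits
  ... | no ¬fits = ⊥-elim (m≡n+1+o⇒m≰n k
      (solve 1 (λ k → con 2 :* (con 5 :+ k) :+ (con 1 :+ k) :* con 3 := con 12 :+ con 4 :* k :+ (con 1 :+ k)) refl k)
      (subst₂ _≤_ (cong₂ (λ s t → 2 * s + (1 + k) * t) size ∣⁅ b≢a ∘ sym , a≢x , b≢x ⁆∣) (degree-sum adm)
        (∑-weighted 2 (1 + k) (λ y → weighted-≤ 2 (1 + k) (A y) (⁅ a , b , x ⁆ y)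
           (lower y) (heavy y) (in-A y)))))
    where
    x≢b : x ≢ b
    x≢b = ─-≢v (A ─ v ─ a) b x∈
    x≢a : x ≢ a
    x≢a = ─-≢v (A ─ v) a (─-⊆ (A ─ v ─ a) b x∈)
    a≢x : a ≢ x
    a≢x = x≢a ∘ sym
    b≢x : b ≢ x
    b≢x = x≢b ∘ sym
    x∈A─v─a : x ∈ A ─ v ─ a
    x∈A─v─a = ─-⊆ (A ─ v ─ a) b x∈
    3+k≤dx : 3 + k ≤ d x
    3+k≤dx = ≤-pred (≤-pred (subst (5 + k ≤_) (+-comm (d x) 2) (≰⇒> ¬fits)))
    members : ∀ y → ⁅ a , b , x ⁆ y ≡ true → y ≡ a ⊎ y ≡ b ⊎ y ≡ x
    members y e with ∨-≡true {P = (y == a) ∨ (y == b)} e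
    ... | inj₂ y≡x = inj₂ (inj₂ (==-sound y≡x))
    ... | inj₁ e′ with ∨-≡true {P = y == a} e′
    ...   | inj₁ y≡a = inj₁ (==-sound y≡a)
    ...   | inj₂ y≡b = inj₂ (inj₁ (==-sound y≡b))
    in-A : ∀ y → ⁅ a , b , x ⁆ y ≡ true → y ∈ A
    in-A y e with members y e
    ... | inj₁ refl        = ─-⊆ A v a∈
    ... | inj₂ (inj₁ refl) = ─-⊆ A v (─-⊆ (A ─ v) a b∈)
    ... | inj₂ (inj₂ refl) = ─-⊆ A v (─-⊆ (A ─ v) a x∈A─v─a)
    heavy : ∀ y → ⁅ a , b , x ⁆ y ≡ true → 3 + k ≤ d y
    heavy y e with members y e
    ... | inj₁ refl        = ≤-trans 3+k≤dx (a-max x (─-⊆ (A ─ v) a x∈A─v─a))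
    ... | inj₂ (inj₁ refl) = ≤-trans 3+k≤dx (b-max x x∈A─v─a)
    ... | inj₂ (inj₂ refl) = 3+k≤dx

  w : Fin N → ℕ
  w x = δ a x + δ b x + 2 * δ v x

  w-v : w v ≡ 2
  w-v = cong₂ _+_ (cong₂ _+_ (δ-other (a≢v ∘ sym)) (δ-other (b≢v ∘ sym))) (cong (2 *_) (δ-same v))

  w-a : w a ≡ 1
  w-a = cong₂ _+_ (cong₂ _+_ (δ-same a) (δ-other (b≢a ∘ sym))) (cong (2 *_) (δ-other a≢v))

  w-b : w b ≡ 1
  w-b = cong₂ _+_ (cong₂ _+_ (δ-other b≢a) (δ-same b)) (cong (2 *_) (δ-other b≢v))

  w-other : ∀ {x} → x ≢ v → x ≢ a → x ≢ b → w x ≡ 0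
  w-other x≢v x≢a x≢b = cong₂ _+_ (cong₂ _+_ (δ-other x≢a) (δ-other x≢b)) (cong (2 *_) (δ-other x≢v))

  ∑w≡4 : ∑ w ≡ 4
  ∑w≡4 = begin
    ∑ w                                   ≡⟨ ∑-distrib-+ (λ x → δ a x + δ b x) (λ x → 2 * δ v x) ⟩
    ∑ (λ x → δ a x + δ b x) + ∑ (λ x → 2 * δ v x)
                                          ≡⟨ cong₂ _+_ (∑-distrib-+ (δ a) (δ b)) (∑-weight 2 v) ⟩
    ∑ (δ a) + ∑ (δ b) + 2                 ≡⟨ cong (λ t → t + 2) (cong₂ _+_ (∑-δ a) (∑-δ b)) ⟩
    4                                     ∎
    where open ≡-Reasoning

  data Role (x : Fin N) : Set where
    is-v : x ≡ v → Role x
    is-a : x ≡ a → Role x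
    is-b : x ≡ b → Role x
    other : x ≢ v → x ≢ a → x ≢ b → Role x

  role : ∀ x → Role x
  role x with x ≟ v | x ≟ a | x ≟ b
  ... | yes x≡v | _       | _       = is-v x≡v
  ... | no _    | yes x≡a | _       = is-a x≡a
  ... | no _    | no _    | yes x≡b = is-b x≡b
  ... | no x≢v  | no x≢a  | no x≢b  = other x≢v x≢a x≢b

  w≤d : ∀ x → w x ≤ d x
  w≤d x with role x
  ... | is-v refl = subst (_≤ d v) (sym w-v) (≤-reflexive (sym dv≡2))
  ... | is-a refl = subst (_≤ d a) (sym w-a) (≤-trans (s≤s z≤n) 3≤da)
  ... | is-b refl = subst (_≤ d b) (sym w-b) (≤-trans (s≤s z≤n) 3≤db)
  ... | other x≢v x≢a x≢b = subst (_≤ d x) (sym (w-other x≢v x≢a x≢b)) z≤n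

  lowered-upper : ∀ n → 3 ≤ n → n + 2 ≤ 5 + k → n ∸ 1 + 2 ≤ 4 + k
  lowered-upper (suc n) _ fits = ≤-pred fits

  admissible : Admissible (A ─ v) (λ x → d x ∸ w x) (4 + k)
  admissible = reduce adm v∈A w w≤d (trans w-v (sym dv≡2)) ∑w≡4 lower′ upper′
    where
    lower′ : ∀ x → x ∈ A ─ v → 2 ≤ d x ∸ w x
    lower′ x x∈ with role x
    ... | is-v refl = ⊥-elim (─-≢v A v x∈ refl)
    ... | is-a refl = subst (λ t → 2 ≤ d a ∸ t) (sym w-a) (m+n≤o⇒m≤o∸n 2 3≤da)
    ... | is-b refl = subst (λ t → 2 ≤ d b ∸ t) (sym w-b) (m+n≤o⇒m≤o∸n 2 3≤db)
    ... | other x≢v x≢a x≢b = subst (λ t → 2 ≤ d x ∸ t) (sym (w-other x≢v x≢a x≢b)) (lower x (─-⊆ A v x∈))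
    upper′ : ∀ x → x ∈ A ─ v → d x ∸ w x + 2 ≤ 4 + k
    upper′ x x∈ with role x
    ... | is-v refl = ⊥-elim (─-≢v A v x∈ refl)
    ... | is-a refl = subst (λ t → d a ∸ t + 2 ≤ 4 + k) (sym w-a) (lowered-upper (d a) 3≤da (upper a (─-⊆ A v x∈)))
    ... | is-b refl = subst (λ t → d b ∸ t + 2 ≤ 4 + k) (sym w-b) (lowered-upper (d b) 3≤db (upper b (─-⊆ A v x∈)))
    ... | other x≢v x≢a x≢b = subst (λ t → d x ∸ t + 2 ≤ 4 + k) (sym (w-other x≢v x≢a x≢b))
                                (other-upper x (∈-─ (A ─ v ─ a) b (∈-─ (A ─ v) a x∈ x≢a) x≢b))

module DegreeThree {A : VertexSet N} {d : Fin N → ℕ} {k : ℕ} (adm : Admissible A d (5 + k))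
                   {v : Fin N} (v∈A : v ∈ A) (dv≡3 : d v ≡ 3) (v-min : ∀ x → x ∈ A → d v ≤ d x)
                   {a : Fin N} (a∈ : a ∈ A ─ v) (a-max : ∀ x → x ∈ A ─ v → d x ≤ d a) where
  open Admissible adm

  a≢v : a ≢ v
  a≢v = ─-≢v A v a∈

  3≤d : ∀ x → x ∈ A → 3 ≤ d x
  3≤d x x∈A = subst (_≤ d x) dv≡3 (v-min x x∈A)

  3≤da : 3 ≤ d a
  3≤da = 3≤d a (─-⊆ A v a∈)

  da≤k : d a ≤ k
  da≤k = subst (_≤ k) (m∸n+n≡m 3≤da) (+-cancelˡ-≤ (12 + 3 * k) _ _ (begin
    12 + 3 * k + (d a ∸ 3 + 3)          ≡⟨ solve 2 (λ k t → con 12 :+ con 3 :* k :+ (t :+ con 3)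
                                                           := con 3 :* (con 5 :+ k) :+ t :* con 1) refl k (d a ∸ 3) ⟩
    3 * (5 + k) + (d a ∸ 3) * 1         ≡⟨ cong₂ (λ s t → 3 * s + (d a ∸ 3) * t) size (∑-δ a) ⟨
    3 * ∣ A ∣ + (d a ∸ 3) * ∑ (δ a)     ≤⟨ (∑-weighted 3 (d a ∸ 3) (λ y → weighted-≤ 3 (d a ∸ 3) (A y) (y == a)
                                                (3≤d y) (heavy y) (λ y≡a → subst (_∈ A) (sym (==-sound y≡a)) (─-⊆ A v a∈)))) ⟩
    ∑ d                                 ≡⟨ degree-sum adm ⟩
    12 + 4 * k                          ≡⟨ solve 1 (λ k → con 12 :+ con 4 :* k := con 12 :+ con 3 :* k :+ k) refl k ⟩
    12 + 3 * k + k                      ∎))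
    where
    open ≤-Reasoning
    heavy : ∀ y → (y == a) ≡ true → 3 + (d a ∸ 3) ≤ d y
    heavy y y≡a rewrite ==-sound {x = y} y≡a = ≤-reflexive (m+[n∸m]≡n 3≤da)

  w : Fin N → ℕ
  w x = δ a x + 3 * δ v x

  w-v : w v ≡ 3
  w-v = cong₂ _+_ (δ-other (a≢v ∘ sym)) (cong (3 *_) (δ-same v))

  w-a : w a ≡ 1
  w-a = cong₂ _+_ (δ-same a) (cong (3 *_) (δ-other a≢v))

  w-other : ∀ {x} → x ≢ v → x ≢ a → w x ≡ 0
  w-other x≢v x≢a = cong₂ _+_ (δ-other x≢a) (cong (3 *_) (δ-other x≢v))

  ∑w≡4 : ∑ w ≡ 4
  ∑w≡4 = trans (∑-distrib-+ (δ a) (λ x → 3 * δ v x)) (cong₂ _+_ (∑-δ a) (∑-weight 3 v))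

  data Role (x : Fin N) : Set where
    is-v  : x ≡ v → Role x
    is-a  : x ≡ a → Role x
    other : x ≢ v → x ≢ a → Role x

  role : ∀ x → Role x
  role x with x ≟ v | x ≟ a
  ... | yes x≡v | _       = is-v x≡v
  ... | no _    | yes x≡a = is-a x≡a
  ... | no x≢v  | no x≢a  = other x≢v x≢a

  w≤d : ∀ x → w x ≤ d x
  w≤d x with role x
  ... | is-v refl = ≤-reflexive (trans w-v (sym dv≡3))
  ... | is-a refl = subst (_≤ d a) (sym w-a) (≤-trans (s≤s z≤n) 3≤da)
  ... | other x≢v x≢a = subst (_≤ d x) (sym (w-other x≢v x≢a)) z≤n

  k+2≤4+k : k + 2 ≤ 4 + k
  k+2≤4+k = subst (_≤ 4 + k) (+-comm 2 k) (m≤n+m (2 + k) 2)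

  admissible : Admissible (A ─ v) (λ x → d x ∸ w x) (4 + k)
  admissible = reduce adm v∈A w w≤d (trans w-v (sym dv≡3)) ∑w≡4 lower′ upper′
    where
    lower′ : ∀ x → x ∈ A ─ v → 2 ≤ d x ∸ w x
    lower′ x x∈ with role x
    ... | is-v refl = ⊥-elim (─-≢v A v x∈ refl)
    ... | is-a refl = subst (λ t → 2 ≤ d a ∸ t) (sym w-a) (m+n≤o⇒m≤o∸n 2 3≤da)
    ... | other x≢v x≢a = subst (λ t → 2 ≤ d x ∸ t) (sym (w-other x≢v x≢a)) (lower x (─-⊆ A v x∈))
    upper′ : ∀ x → x ∈ A ─ v → d x ∸ w x + 2 ≤ 4 + k
    upper′ x x∈ with role x
    ... | is-v refl = ⊥-elim (─-≢v A v x∈ refl)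
    ... | is-a refl = subst (λ t → d a ∸ t + 2 ≤ 4 + k) (sym w-a)
                        (≤-trans (+-monoˡ-≤ 2 (≤-trans (m∸n≤m (d a) 1) da≤k)) k+2≤4+k)
    ... | other x≢v x≢a = subst (λ t → d x ∸ t + 2 ≤ 4 + k) (sym (w-other x≢v x≢a))
                            (≤-trans (+-monoˡ-≤ 2 (≤-trans (a-max x x∈) da≤k)) k+2≤4+k)

  module _ (C : Certificate (A ─ v) (λ x → d x ∸ w x)) where
    open Certificate C
    open RootedTree T₁ using (parent)
    module T₁ = Tree T₁

    good : VertexSet N
    good x = (A ─ v ─ c₁) x ∧ (not (x == a) ∧ (not (parent x == a) ∧ (not (x == c₂) ∧ (not (x == c₃) ∧ not (x == c₄)))))

    non-roots : ∣ A ─ v ─ c₁ ∣ ≡ 3 + k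
    non-roots = suc-injective (trans (sym (∣─∣ (A ─ v) c₁ (RootedTree.root∈ T₁))) (Admissible.size admissible))

    T₁-degree-a : ∣ T₁.link a ∣ ≤ d a ∸ 1
    T₁-degree-a = ≤-trans (∑-mono-≤ (λ y → b2n-≤-∨ (T₁.link a y) _))
                          (≤-reflexive (trans (degrees a) (cong (d a ∸_) w-a)))

    -- Without a good vertex every non-root vertex of the first tree is  a, a child of  a,
    -- or one of c₂, c₃, c₄.
    bad-count : (∀ x → x ∉ good) → ∣ A ─ v ─ c₁ ∣ ≤ ∣ T₁.link a ∣ + 3
    bad-count none = begin
      ∣ A ─ v ─ c₁ ∣                                 ≤⟨ ∑-mono-≤ (λ x → bad-vertex-bound ((A ─ v ─ c₁) x) (x == a) (parent x == a)
                                                                                        (x == c₂) (x == c₃) (x == c₄) (none x)) ⟩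
      ∑ (λ x → b2n ((A ─ v ─ c₁) x ∧ (x == a)) + rest x)
                                                     ≡⟨ ∑-distrib-+ (λ x → b2n ((A ─ v ─ c₁) x ∧ (x == a))) rest ⟩
      ∑ (λ x → b2n ((A ─ v ─ c₁) x ∧ (x == a))) + ∑ rest
                                                     ≡⟨ cong₂ _+_ at-a ∑rest ⟩
      b2n ((A ─ v ─ c₁) a) + (∣ (λ x → T₁.isChildOf x a) ∣ + 3)
                                                     ≡⟨ +-assoc (b2n ((A ─ v ─ c₁) a)) _ 3 ⟨
      b2n ((A ─ v ─ c₁) a) + ∣ (λ x → T₁.isChildOf x a) ∣ + 3
                                                     ≡⟨ cong (_+ 3) (T₁.tree-degree a) ⟨
      ∣ T₁.link a ∣ + 3                              ∎
      where
      open ≤-Reasoning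
      at-a : ∑ (λ x → b2n ((A ─ v ─ c₁) x ∧ (x == a))) ≡ b2n ((A ─ v ─ c₁) a)
      at-a = trans (∑-point _ a (λ x x≢a → cong b2n (trans (cong ((A ─ v ─ c₁) x ∧_) (==-≢ x≢a)) (∧-zeroʳ _))))
                   (cong b2n (trans (cong ((A ─ v ─ c₁) a ∧_) (==-refl a)) (∧-identityʳ _)))
      rest : Fin N → ℕ
      rest x = b2n (T₁.isChildOf x a) + (δ c₂ x + (δ c₃ x + δ c₄ x))
      ∑rest : ∑ rest ≡ ∣ (λ x → T₁.isChildOf x a) ∣ + 3
      ∑rest = trans (∑-distrib-+ (λ x → b2n (T₁.isChildOf x a)) (λ x → δ c₂ x + (δ c₃ x + δ c₄ x)))
        (cong (∣ (λ x → T₁.isChildOf x a) ∣ +_) (trans (∑-distrib-+ (δ c₂) (λ x → δ c₃ x + δ c₄ x))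
          (cong₂ _+_ (∑-δ c₂) (trans (∑-distrib-+ (δ c₃) (δ c₄)) (cong₂ _+_ (∑-δ c₃) (∑-δ c₄))))))

    no-good-is-absurd : (∀ x → x ∉ good) → ⊥
    no-good-is-absurd none = <-irrefl refl (<-≤-trans (≤-<-trans k≤ (∸1< (d a) (≤-trans (s≤s z≤n) 3≤da))) da≤k)
      where
      ∸1< : ∀ n → 1 ≤ n → n ∸ 1 < n
      ∸1< (suc n) _ = ≤-refl
      k≤ : k ≤ d a ∸ 1
      k≤ = +-cancelʳ-≤ 3 k (d a ∸ 1) (subst (_≤ d a ∸ 1 + 3) (trans non-roots (+-comm 3 k))
             (≤-trans (bad-count none) (+-monoˡ-≤ 3 T₁-degree-a)))

    good-elim : ∀ {x} → good x ≡ true →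
                x ∈ A ─ v ─ c₁ × x ≢ a × parent x ≢ a × x ≢ c₂ × x ≢ c₃ × x ≢ c₄
    good-elim {x} g with (A ─ v ─ c₁) x | x ≟ a | parent x ≟ a | x ≟ c₂ | x ≟ c₃ | x ≟ c₄
    ... | true | no x≢a | no p≢a | no x≢c₂ | no x≢c₃ | no x≢c₄ = refl , x≢a , p≢a , x≢c₂ , x≢c₃ , x≢c₄

    site : SubdivisionSite C a
    site with find good
    ... | inj₁ none = ⊥-elim (no-good-is-absurd none)
    ... | inj₂ (x₀ , good-x₀) with good-elim good-x₀
    ...   | x₀∈ , x₀≢a , p≢a , x₀≢c₂ , x₀≢c₃ , x₀≢c₄ = record
      { x₀ = x₀ ; x₀∈ = x₀∈ ; x₀≢a = x₀≢a ; p≢a = p≢a ; x₀≢c₂ = x₀≢c₂ ; x₀≢c₃ = x₀≢c₃ ; x₀≢c₄ = x₀≢c₄ }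

module Step {k : ℕ} (induction : ∀ {A : VertexSet N} {d : Fin N → ℕ} → Admissible A d (4 + k) → Certificate A d)
            {A : VertexSet N} {d : Fin N → ℕ} (adm : Admissible A d (5 + k)) {v : Fin N} (v∈A : v ∈ A) where
  open Admissible adm

  ∣A─v∣ : ∣ A ─ v ∣ ≡ 4 + k
  ∣A─v∣ = suc-injective (trans (sym (∣─∣ A v v∈A)) size)

  remove-degree-two : d v ≡ 2 → Certificate A d
  remove-degree-two dv≡2 with argmax d ∣A─v∣
  ... | a , a∈ , a-max with argmax d (suc-injective (trans (sym (∣─∣ (A ─ v) a a∈)) ∣A─v∣))
  ... | b , b∈ , b-max =
    AddLeaves.certificate v∈A (induction admissible) a∈ (─-⊆ (A ─ v) a b∈) (b≢a ∘ sym) d (λ x → sym (m∸n+n≡m (w≤d x)))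
    where open DegreeTwo adm v∈A dv≡2 a∈ a-max b∈ b-max

  remove-degree-three : d v ≡ 3 → (∀ x → x ∈ A → d v ≤ d x) → Certificate A d
  remove-degree-three dv≡3 v-min with argmax d ∣A─v∣
  ... | a , a∈ , a-max =
    SubdivideAndAttach.certificate v∈A C a∈ (site C) d (λ x → sym (m∸n+n≡m (w≤d x)))
    where
    open DegreeThree adm v∈A dv≡3 v-min a∈ a-max
    C : Certificate (A ─ v) (λ x → d x ∸ w x)
    C = induction admissible

certificate : (k : ℕ) {A : VertexSet N} {d : Fin N → ℕ} → Admissible A d (4 + k) → Certificate A d
certificate zero adm = FourCycle.certificate (enumerate₄ size)
  (λ x x∈A → ≤-antisym (+-cancelʳ-≤ 2 _ 2 (upper x x∈A)) (lower x x∈A)) outside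
  where open Admissible adm
certificate (suc k) {d = d} adm with argmin d (Admissible.size adm)
... | v , v∈A , v-min with d v in dv | Admissible.lower adm v v∈A | min-degree≤3 adm v-min
...   | 2 | _ | _ = Step.remove-degree-two (certificate k) adm v∈A dv
...   | 3 | _ | _ = Step.remove-degree-three (certificate k) adm v∈A dv v-min
...   | 1 | s≤s () | _
...   | suc (suc (suc (suc _))) | _ | s≤s (s≤s (s≤s ()))

∣full∣ : (n : ℕ) → ∣ (λ (_ : Fin n) → true) ∣ ≡ n
∣full∣ zero    = refl
∣full∣ (suc n) = cong suc (∣full∣ n)

pivotable-realization : (k : ℕ) (d : Fin (4 + k) → ℕ) → (∀ x → 2 ≤ d x) → (∀ x → d x + 2 ≤ 4 + k) →
                        ∑ d ≡ 8 + 4 * k → Σ (Graph (4 + k)) λ G → Realization d G × C4Pivotable G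
pivotable-realization k d lower upper ∑d≡ =
  G , realizes , edgeCount≡ ,
  c₁ , c₂ , c₃ , c₄ , induced , T₁.graph , T₂.graph , spanning₁ full , spanning₂ full , shared-edges , shared⊆C4
  where
  full : ∀ x → x ∈ (λ _ → true)
  full _ = refl
  C : Certificate (λ _ → true) d
  C = certificate k (record
    { size    = ∣full∣ (4 + k)
    ; outside = λ x ()
    ; lower   = λ x _ → lower x
    ; upper   = λ x _ → upper x
    ; total   = trans (cong (_+ 8) ∑d≡) (solve 1 (λ k → con 8 :+ con 4 :* k :+ con 8 := con 4 :* (con 4 :+ k)) refl k) })
  open Certificate C using (c₁; c₂; c₃; c₄)
  open FromCertificate C
  edgeCount≡ : edgeCount G ≡ 2 * (4 + k) ∸ 4
  edgeCount≡ = *-cancelˡ-≡ _ _ 2 (begin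
    2 * edgeCount G               ≡⟨ edges ⟩
    ∑ d                           ≡⟨ ∑d≡ ⟩
    8 + 4 * k                     ≡⟨ solve 1 (λ k → con 8 :+ con 4 :* k := con 2 :* (con 4 :+ con 2 :* k)) refl k ⟩
    2 * (4 + 2 * k)               ≡⟨ cong (2 *_) (m+n∸m≡n 4 (4 + 2 * k)) ⟨
    2 * (4 + (4 + 2 * k) ∸ 4)     ≡⟨ cong (λ t → 2 * (t ∸ 4))
                                        (solve 1 (λ k → con 2 :* (con 4 :+ k) := con 4 :+ (con 4 :+ con 2 :* k)) refl k) ⟨
    2 * (2 * (4 + k) ∸ 4)         ∎)
    where open ≡-Reasoning

module _ {m : ℕ} {d : Fin (suc m) → ℕ} (non-increasing : NonIncreasing d)
         (d₀<m : d zero < m) (2≤dₙ : 2 ≤ d (fromℕ m)) where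

  at-least-2 : ∀ x → 2 ≤ d x
  at-least-2 x = ≤-trans 2≤dₙ (non-increasing x (fromℕ m)
    (subst (toℕ x ≤_) (sym (toℕ-fromℕ m)) (toℕ≤pred[n] x)))

  at-most : ∀ x → d x + 2 ≤ suc m
  at-most x = subst (_≤ suc m) (+-comm 2 (d x)) (s≤s (≤-trans (s≤s (non-increasing zero x z≤n)) d₀<m))

lemma4p3 : (m : ℕ) → (d : Fin (suc m) → ℕ) → Graphical d →
    degSum d ≡ 4 * m ∸ 4 → d zero < m → 2 ≤ d (fromℕ m) →
    Σ (Graph (suc m)) λ G → Realization d G × C4Pivotable G
lemma4p3 (suc (suc (suc k))) d (non-increasing , _) degSum≡ d₀<m 2≤dₙ =
  pivotable-realization k d (at-least-2 non-increasing d₀<m 2≤dₙ) (at-most non-increasing d₀<m 2≤dₙ) (begin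
    ∑ d                           ≡⟨ sum-allFin d ⟨
    degSum d                      ≡⟨ degSum≡ ⟩
    4 * (3 + k) ∸ 4               ≡⟨ cong (_∸ 4) (solve 1 (λ k → con 4 :* (con 3 :+ k) := con 4 :+ (con 8 :+ con 4 :* k)) refl k) ⟩
    4 + (8 + 4 * k) ∸ 4           ≡⟨ m+n∸m≡n 4 (8 + 4 * k) ⟩
    8 + 4 * k                     ∎)
  where open ≡-Reasoning
lemma4p3 zero d _ _ () _
lemma4p3 (suc zero) d (non-increasing , _) _ d₀<m 2≤dₙ with ≤-trans (s≤s (at-least-2 non-increasing d₀<m 2≤dₙ zero)) d₀<m
... | s≤s ()
lemma4p3 (suc (suc zero)) d (non-increasing , _) _ d₀<m 2≤dₙ with ≤-trans (s≤s (at-least-2 non-increasing d₀<m 2≤dₙ zero)) d₀<m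
... | s≤s (s≤s ())
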